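{- Let $A_1\ldots A_n$ be a convex $n$-gon with integer vertices. Then the winding number about the origin of its sail diagram equals $n/2-1$.
   Context: Vertices $A_1,\ldots,A_n$ are listed consecutively (anticlockwise), indices mod $n$. The sail of a rational integer angle is the union of the bounded edges of the boundary of the convex hull of all integer points of the angle except its vertex; for $\angle A_{i-1}A_iA_{i+1}$ its vertices are listed from the one on ray $A_iA_{i-1}$ to the one on ray $A_iA_{i+1}$. Sail diagram: for $i=1,\ldots,n$, let $\sigma_i$ be the sail of $\angle A_{i-1}A_iA_{i+1}$ translated by the vector $-A_i$ (so the vertex goes to the origin) and, if $i$ is even, additionally composed with the central symmetry $v\mapsto -v$; the sail diagram is the broken line obtained by concatenating $\sigma_1,\sigma_2,\ldots,\sigma_n$ (the last vertex of $\sigma_i$ coincides with the first vertex of $\sigma_{i+1}$). Winding number of a broken line $P_0\ldots P_m$ about a point $O$: $\omega=\frac{1}{2\pi}\sum_{j=1}^m\mu(\angle P_{j-1}OP_j)$, where $\mu$ is the Euclidean angular measure (in $[0,\pi]$). -}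

module Defs where

open import Data.Nat as ℕ using (ℕ; zero; suc)
open import Data.Nat.DivMod using (_%_; m%n<n)
open import Data.Nat.GCD using (gcd)
open import Data.Integer as ℤ using (ℤ; +_; _+_; _-_; _*_; -_; ∣_∣; _≤_; _<_; _<?_; _≟_)
open import Data.Fin using (Fin; toℕ; fromℕ<)
open import Data.List using (List; []; _∷_; map; concat; head; last; allFin)
open import Data.List.Relation.Unary.All using (All)
open import Data.List.Membership.Propositional using (_∈_)
open import Data.Maybe using (just)
open import Data.Product using (Σ; _×_; _,_; proj₁; proj₂)
open import Data.Bool using (Bool; if_then_else_; _∨_; _∧_)
open import Relation.Nullary using (¬_; does)
open import Relation.Binary.PropositionalEquality using (_≡_)

Point : Set
Point = ℤ × ℤ

_⊖_ : Point → Point → Point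
(a , b) ⊖ (c , d) = (a - c , b - d)

negP : Point → Point
negP (a , b) = (- a , - b)

cross : Point → Point → ℤ
cross (a , b) (c , d) = a * d - b * c

dot : Point → Point → ℤ
dot (a , b) (c , d) = a * c + b * d

-- X is a point of the (closed) angle ∠PVQ (the cone at V spanned by the
-- rays VP and VQ; the angle is assumed nondegenerate, cross ≠ 0).
InAngle : Point → Point → Point → Point → Set
InAngle V P Q X =
  (+ 0 ≤ cross p x * cross p q) × (+ 0 ≤ cross x q * cross p q)
  where
    p = P ⊖ V
    q = Q ⊖ V
    x = X ⊖ V

SailSet : Point → Point → Point → Point → Set
SailSet V P Q X = InAngle V P Q X × ¬ (X ≡ V)

-- X is the first integer point (≠ V) on the ray from V through R
FirstOnRay : Point → Point → Point → Set
FirstOnRay V R X =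
  (cross x r ≡ + 0) × (+ 0 < dot x r) × (gcd ∣ proj₁ x ∣ ∣ proj₂ x ∣ ≡ 1)
  where
    r = R ⊖ V
    x = X ⊖ V

pairs : {A : Set} → List A → List (A × A)
pairs (x ∷ y ∷ xs) = (x , y) ∷ pairs (y ∷ xs)
pairs _ = []

triples : {A : Set} → List A → List (A × A × A)
triples (x ∷ y ∷ z ∷ xs) = (x , y , z) ∷ triples (y ∷ z ∷ xs)
triples _ = []

-- The segment [a,b] lies on a supporting line of the convex hull of the
-- integer points of the angle other than V: all those points lie in one
-- closed half-plane of the line ab, and V lies strictly in the other.
SupportingEdge : Point → Point → Point → Point × Point → Set
SupportingEdge V P Q (a , b) =
  ¬ (cross (b ⊖ a) (V ⊖ a) ≡ + 0) ×
  (∀ X → SailSet V P Q X → cross (b ⊖ a) (X ⊖ a) * cross (b ⊖ a) (V ⊖ a) ≤ + 0)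

-- three consecutive vertices are not collinear (each listed point is a
-- genuine vertex of the boundary)
StrictTurn : Point × Point × Point → Set
StrictTurn (a , b , c) = ¬ (cross (b ⊖ a) (c ⊖ a) ≡ + 0)

-- L is the list of vertices of the sail of the angle ∠PVQ, listed from the
-- vertex on the ray VP to the vertex on the ray VQ; i.e. the broken line of
-- bounded edges of the boundary of the convex hull of the integer points of
-- the angle other than V.
record IsSail (V P Q : Point) (L : List Point) : Set where
  field
    startsOnRayP : Σ Point λ X → (head L ≡ just X) × FirstOnRay V P X
    endsOnRayQ   : Σ Point λ X → (last L ≡ just X) × FirstOnRay V Q X
    allInSet     : All (SailSet V P Q) L
    edges        : All (SupportingEdge V P Q) (pairs L)
    vertices     : All StrictTurn (triples L)

next : {m : ℕ} → Fin (suc m) → Fin (suc m)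
next {m} i = fromℕ< (m%n<n (suc (toℕ i)) (suc m))

prev : {m : ℕ} → Fin (suc m) → Fin (suc m)
prev {m} i = fromℕ< (m%n<n (toℕ i ℕ.+ m) (suc m))

ConvexCCW : {m : ℕ} → (Fin (suc m) → Point) → Set
ConvexCCW {m} A =
  ∀ i j → ¬ (j ≡ i) → ¬ (j ≡ next i) →
  + 0 < cross (A (next i) ⊖ A i) (A j ⊖ A i)

-- Given the sails S i of the angles ∠A_{i-1}A_iA_{i+1}, the i-th piece:
-- translated by -A_i, and centrally reflected when the paper's (1-based)
-- index toℕ i + 1 is even, i.e. when toℕ i is odd.
piece : {m : ℕ} → (Fin (suc m) → Point) → (Fin (suc m) → List Point) →
        Fin (suc m) → List Point
piece A S i = map (λ X → sgn (X ⊖ A i)) (S i)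
  where
    sgn : Point → Point
    sgn v = if does (toℕ i % 2 ℕ.≟ 1) then negP v else v

sailDiagram : {m : ℕ} → (Fin (suc m) → Point) → (Fin (suc m) → List Point) →
              List Point
sailDiagram {m} A S = concat (map (piece A S) (allFin (suc m)))

-- A nonzero Gaussian integer w = (re , im) represents the direction arg w.
-- The state (k , w) with w in the half-plane H = {im > 0} ∪ {im = 0, re > 0}
-- represents the real angle  k·π + arg w  (arg w ∈ [0, π)).

G : Set
G = ℤ × ℤ

mulG : G → G → G
mulG (a , b) (c , d) = (a * c - b * d , a * d + b * c)

inH : G → Bool
inH (re , im) = does (+ 0 <? im) ∨ (does (im ≟ + 0) ∧ does (+ 0 <? re))

-- rotation by the Euclidean angle μ(∠POQ) ∈ [0, π] (O the origin):
-- conj(P)·Q = (dot , cross), reflected into the closed upper half-plane.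
rotμ : Point → Point → G
rotμ P Q = (dot P Q , + ∣ cross P Q ∣)

addAngle : ℕ × G → G → ℕ × G
addAngle (k , w) r =
  if inH w' then (k , w') else (suc k , negP w')
  where w' = mulG w r

angleSumFrom : ℕ × G → List Point → ℕ × G
angleSumFrom s (P ∷ Q ∷ L) = angleSumFrom (addAngle s (rotμ P Q)) (Q ∷ L)
angleSumFrom s _ = s

-- Σ_j μ(∠P_{j-1} O P_j), encoded as (k , w) meaning k·π + arg w
angleSum : List Point → ℕ × G
angleSum = angleSumFrom (0 , (+ 1 , + 0))

-- the winding number about the origin of the broken line L equals k/2,
-- i.e.  Σ_j μ(∠P_{j-1} O P_j) = k·π
WindingNumberIsHalf : List Point → ℕ → Set
WindingNumberIsHalf L k =
  (proj₁ (angleSum L) ≡ k) ×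
  (proj₂ (proj₂ (angleSum L)) ≡ + 0) × (+ 0 < proj₁ (proj₂ (angleSum L)))

{-# OPTIONS --safe #-}

-- The angle sum Σ μ(∠P_{j-1} O P_j) of the sail diagram is computed exactly, as kπ + arg w. Every
-- step of the diagram turns clockwise by at most π, so modulo π the accumulated angle is the
-- clockwise angle from the first point L to the current point, and k counts how often the current
-- point changes side with respect to the line of L. Within one sail, a convex clockwise arc of less
-- than a half-turn, this happens at most once, and consecutive sails meet along a common edge
-- direction, so the count splits over the vertices: A_i contributes 1 exactly when its two edges
-- lie on the same side of L (the central symmetry applied to every other sail cancels out). Since
-- L points along A_0 A_{n-1} and the edge directions of a convex polygon turn monotonically, the
-- sides of the edges A_0 A_1, ..., A_{n-1} A_0 form a block of one value followed by a block of the
-- other, so exactly n - 2 vertices contribute. Finally the diagram closes up on the line of L, so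
-- w ends up real and positive.

module Submission where

open import Defs

-- Inside this module _≤_ and _<_ are the integer orders; mainTheorem4 below uses ℕ's _≤_.
module _ where

  open import Data.Bool using (Bool; true; false; not; _xor_; if_then_else_)
  open import Data.Bool.Properties using (not-involutive; not-injective; not-distribˡ-xor; xor-same; ¬-not)
  open import Data.Empty using (⊥; ⊥-elim)
  open import Data.Fin using (Fin; zero; suc; toℕ; fromℕ; inject₁)
  import Data.Fin.Properties as Finₚ
  open import Data.Fin.Relation.Unary.Top using (view; ‵fromℕ; ‵inject₁)
  open import Data.Integer
    using (ℤ; +_; -[1+_]; +[1+_]; 0ℤ; 1ℤ; _+_; _-_; _*_; -_; ∣_∣; _≤_; _<_; _≥_; _>_; _<?_; _≟_;
           +≤+; +<+; positive; negative; nonNegative)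
  import Data.Integer.Properties as ℤₚ
  open import Data.Integer.Tactic.RingSolver using (solve-∀)
  open import Data.List using (List; []; _∷_; _++_; map; concat; tabulate; last)
  open import Data.List.Properties using (map-∘; map-id; map-tabulate; tabulate-cong)
  open import Data.List.Relation.Unary.All using (All; []; _∷_)
  import Data.List.Relation.Unary.All as All
  import Data.List.Relation.Unary.All.Properties as Allₚ
  open import Data.Maybe using (just)
  import Data.Maybe.Properties as Maybeₚ
  open import Data.Nat as ℕ using (ℕ; zero; suc; _∸_; _%_; s≤s; z<s)
  import Data.Nat.Properties as ℕₚ
  open import Data.Nat.DivMod using (m<n⇒m%n≡m; n%n≡0; [m+n]%n≡m%n)
  open import Algebra.Properties.Monoid.Sum ℕₚ.+-0-monoid using (sum; sum-cong-≗)
  open import Data.Product using (Σ; _×_; _,_; proj₁; proj₂)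
  open import Data.Sum using (_⊎_; inj₁; inj₂)
  open import Data.Unit using (⊤; tt)
  open import Function using (_∘_; id; mk⇔)
  open import Relation.Binary using (tri<; tri≈; tri>)
  open import Relation.Binary.PropositionalEquality
    using (_≡_; _≢_; refl; sym; trans; cong; cong₂; subst; module ≡-Reasoning)
  open import Relation.Nullary using (¬_; Dec; yes; no; does; proof)
  open import Relation.Nullary.Decidable using (dec-true; dec-false; does-⇔; _⊎-dec_; _×-dec_; ¬?)
  open import Relation.Nullary.Reflects using (Reflects; invert)

  open ≡-Reasoning

  square-pos : ∀ {i} → i ≢ 0ℤ → i * i > 0ℤ
  square-pos {+ zero} i≢0 = ⊥-elim (i≢0 refl)
  square-pos {+[1+ n ]} _ = +<+ z<s
  square-pos { -[1+ n ]} _ = +<+ z<s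

  square-nonNeg : ∀ i → i * i ≥ 0ℤ
  square-nonNeg i with i ≟ 0ℤ
  ... | yes refl = ℤₚ.≤-refl
  ... | no i≢0 = ℤₚ.<⇒≤ (square-pos i≢0)

  i>0∧j>0⇒i*j>0 : ∀ {i j} → i > 0ℤ → j > 0ℤ → i * j > 0ℤ
  i>0∧j>0⇒i*j>0 {i} {j} i>0 j>0 =
    subst (_< i * j) (ℤₚ.*-zeroʳ i) (ℤₚ.*-monoˡ-<-pos i ⦃ positive i>0 ⦄ j>0)

  i>0∧j<0⇒i*j<0 : ∀ {i j} → i > 0ℤ → j < 0ℤ → i * j < 0ℤ
  i>0∧j<0⇒i*j<0 {i} {j} i>0 j<0 =
    subst (i * j <_) (ℤₚ.*-zeroʳ i) (ℤₚ.*-monoˡ-<-pos i ⦃ positive i>0 ⦄ j<0)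

  i<0∧j<0⇒i*j>0 : ∀ {i j} → i < 0ℤ → j < 0ℤ → i * j > 0ℤ
  i<0∧j<0⇒i*j>0 {i} {j} i<0 j<0 =
    subst (_< i * j) (ℤₚ.*-zeroʳ i) (ℤₚ.*-monoˡ-<-neg i ⦃ negative i<0 ⦄ j<0)

  i≥0∧j≥0⇒i*j≥0 : ∀ {i j} → i ≥ 0ℤ → j ≥ 0ℤ → i * j ≥ 0ℤ
  i≥0∧j≥0⇒i*j≥0 {i} {j} i≥0 j≥0 =
    subst (_≤ i * j) (ℤₚ.*-zeroʳ i) (ℤₚ.*-monoˡ-≤-nonNeg i ⦃ nonNegative i≥0 ⦄ j≥0)

  i≥0∧j≤0⇒i*j≤0 : ∀ {i j} → i ≥ 0ℤ → j ≤ 0ℤ → i * j ≤ 0ℤ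
  i≥0∧j≤0⇒i*j≤0 {i} {j} i≥0 j≤0 =
    subst (i * j ≤_) (ℤₚ.*-zeroʳ i) (ℤₚ.*-monoˡ-≤-nonNeg i ⦃ nonNegative i≥0 ⦄ j≤0)

  i*j≥0∧j<0⇒i≤0 : ∀ {i j} → i * j ≥ 0ℤ → j < 0ℤ → i ≤ 0ℤ
  i*j≥0∧j<0⇒i≤0 ij≥0 j<0 = ℤₚ.≮⇒≥ (λ i>0 → ℤₚ.<⇒≱ (i>0∧j<0⇒i*j<0 i>0 j<0) ij≥0)

  i*j≤0∧j<0⇒i≥0 : ∀ {i j} → i * j ≤ 0ℤ → j < 0ℤ → i ≥ 0ℤ
  i*j≤0∧j<0⇒i≥0 ij≤0 j<0 = ℤₚ.≮⇒≥ (λ i<0 → ℤₚ.<⇒≱ (i<0∧j<0⇒i*j>0 i<0 j<0) ij≤0)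

  i*j≤0∧i>0⇒j≤0 : ∀ {i j} → i * j ≤ 0ℤ → i > 0ℤ → j ≤ 0ℤ
  i*j≤0∧i>0⇒j≤0 ij≤0 i>0 = ℤₚ.≮⇒≥ (λ j>0 → ℤₚ.<⇒≱ (i>0∧j>0⇒i*j>0 i>0 j>0) ij≤0)

  i*j>0∧i>0⇒j>0 : ∀ {i j} → i * j > 0ℤ → i > 0ℤ → j > 0ℤ
  i*j>0∧i>0⇒j>0 ij>0 i>0 =
    ℤₚ.≰⇒> (λ j≤0 → ℤₚ.<⇒≱ ij>0 (i≥0∧j≤0⇒i*j≤0 (ℤₚ.<⇒≤ i>0) j≤0))

  i*j≡0∧i≢0⇒j≡0 : ∀ {i j} → i * j ≡ 0ℤ → i ≢ 0ℤ → j ≡ 0ℤ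
  i*j≡0∧i≢0⇒j≡0 {i} ij≡0 i≢0 with ℤₚ.i*j≡0⇒i≡0∨j≡0 i ij≡0
  ... | inj₁ i≡0 = ⊥-elim (i≢0 i≡0)
  ... | inj₂ j≡0 = j≡0

  c*i≡d*j∧j≤0⇒i≤0 : ∀ {c d i j} → c > 0ℤ → d > 0ℤ → c * i ≡ d * j → j ≤ 0ℤ → i ≤ 0ℤ
  c*i≡d*j∧j≤0⇒i≤0 c>0 d>0 ci≡dj j≤0 =
    i*j≤0∧i>0⇒j≤0 (subst (_≤ 0ℤ) (sym ci≡dj) (i≥0∧j≤0⇒i*j≤0 (ℤₚ.<⇒≤ d>0) j≤0)) c>0

  +∣i∣≡-i : ∀ {i} → i ≤ 0ℤ → + ∣ i ∣ ≡ - i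
  +∣i∣≡-i {+ zero} _ = refl
  +∣i∣≡-i { -[1+ n ]} _ = refl
  +∣i∣≡-i {+[1+ n ]} (+≤+ ())

  origin : Point
  origin = (0ℤ , 0ℤ)

  infixl 6 _⊕_
  _⊕_ : Point → Point → Point
  (a , b) ⊕ (c , d) = (a + c , b + d)

  scale : ℤ → Point → Point
  scale k (a , b) = (k * a , k * b)

  ⊕-identityʳ : ∀ v → v ⊕ origin ≡ v
  ⊕-identityʳ (a , b) = cong₂ _,_ (ℤₚ.+-identityʳ a) (ℤₚ.+-identityʳ b)

  scale-origin : ∀ k → scale k origin ≡ origin
  scale-origin k = cong₂ _,_ (ℤₚ.*-zeroʳ k) (ℤₚ.*-zeroʳ k)

  scale-scale : ∀ j k v → scale j (scale k v) ≡ scale (j * k) v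
  scale-scale j k (a , b) = sym (cong₂ _,_ (ℤₚ.*-assoc j k a) (ℤₚ.*-assoc j k b))

  scale-negP : ∀ k v → scale k (negP v) ≡ negP (scale k v)
  scale-negP k (a , b) = sym (cong₂ _,_ (ℤₚ.neg-distribʳ-* k a) (ℤₚ.neg-distribʳ-* k b))

  scale-neg : ∀ k v → scale (- k) v ≡ negP (scale k v)
  scale-neg k (a , b) = sym (cong₂ _,_ (ℤₚ.neg-distribˡ-* k a) (ℤₚ.neg-distribˡ-* k b))

  negP-involutive : ∀ v → negP (negP v) ≡ v
  negP-involutive (a , b) = cong₂ _,_ (ℤₚ.neg-involutive a) (ℤₚ.neg-involutive b)

  scale-cancel : ∀ {k} v → k ≢ 0ℤ → scale k v ≡ origin → v ≡ origin
  scale-cancel (a , b) k≢0 kv≡0 =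
    cong₂ _,_ (i*j≡0∧i≢0⇒j≡0 (cong proj₁ kv≡0) k≢0) (i*j≡0∧i≢0⇒j≡0 (cong proj₂ kv≡0) k≢0)

  negP-≢origin : ∀ {v} → v ≢ origin → negP v ≢ origin
  negP-≢origin {a , b} v≢0 -v≡0 =
    v≢0 (cong₂ _,_ (ℤₚ.neg-injective (cong proj₁ -v≡0)) (ℤₚ.neg-injective (cong proj₂ -v≡0)))

  ⊖-≢origin : ∀ {X V} → X ≢ V → X ⊖ V ≢ origin
  ⊖-≢origin {x₁ , x₂} {v₁ , v₂} X≢V X-V≡0 =
    X≢V (cong₂ _,_ (ℤₚ.i-j≡0⇒i≡j x₁ v₁ (cong proj₁ X-V≡0))
                   (ℤₚ.i-j≡0⇒i≡j x₂ v₂ (cong proj₂ X-V≡0)))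

  dot-self>0 : ∀ {v} → v ≢ origin → dot v v > 0ℤ
  dot-self>0 {a , b} v≢0 with a ≟ 0ℤ | b ≟ 0ℤ
  ... | yes refl | yes refl = ⊥-elim (v≢0 refl)
  ... | no a≢0 | _ = ℤₚ.+-mono-<-≤ (square-pos a≢0) (square-nonNeg b)
  ... | yes refl | no b≢0 = ℤₚ.+-mono-≤-< (square-nonNeg 0ℤ) (square-pos b≢0)

  dot>0⇒≢originˡ : ∀ {x r} → dot x r > 0ℤ → x ≢ origin
  dot>0⇒≢originˡ dot>0 refl = ℤₚ.<-irrefl refl dot>0

  dot>0⇒≢originʳ : ∀ {x r} → dot x r > 0ℤ → r ≢ origin
  dot>0⇒≢originʳ {x₁ , x₂} dot>0 refl =
    ℤₚ.<-irrefl (sym (cong₂ _+_ (ℤₚ.*-zeroʳ x₁) (ℤₚ.*-zeroʳ x₂))) dot>0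

  cross>0⇒≢originˡ : ∀ {u v} → cross u v > 0ℤ → u ≢ origin
  cross>0⇒≢originˡ cross>0 refl = ℤₚ.<-irrefl refl cross>0

  cross-antisym : ∀ u v → cross v u ≡ - cross u v
  cross-antisym (a , b) (c , d) = identity a b c d
    where
    identity : ∀ a b c d → c * b - d * a ≡ - (a * d - b * c)
    identity = solve-∀

  cross-self : ∀ u → cross u u ≡ 0ℤ
  cross-self (a , b) = identity a b
    where
    identity : ∀ a b → a * b - b * a ≡ 0ℤ
    identity = solve-∀

  cross-negP : ∀ u v → cross (negP u) (negP v) ≡ cross u v
  cross-negP (a , b) (c , d) = identity a b c d
    where
    identity : ∀ a b c d → (- a) * (- d) - (- b) * (- c) ≡ a * d - b * c
    identity = solve-∀

  cross-negPʳ : ∀ u v → cross u (negP v) ≡ - cross u v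
  cross-negPʳ (a , b) (c , d) = identity a b c d
    where
    identity : ∀ a b c d → a * (- d) - b * (- c) ≡ - (a * d - b * c)
    identity = solve-∀

  dot-negP : ∀ u v → dot (negP u) (negP v) ≡ dot u v
  dot-negP (a , b) (c , d) = identity a b c d
    where
    identity : ∀ a b c d → (- a) * (- c) + (- b) * (- d) ≡ a * c + b * d
    identity = solve-∀

  cross-scaleˡ : ∀ k u v → cross (scale k u) v ≡ k * cross u v
  cross-scaleˡ k (a , b) (c , d) = identity k a b c d
    where
    identity : ∀ k a b c d → (k * a) * d - (k * b) * c ≡ k * (a * d - b * c)
    identity = solve-∀

  cross-scaleʳ : ∀ k u v → cross u (scale k v) ≡ k * cross u v
  cross-scaleʳ k (a , b) (c , d) = identity k a b c d
    where
    identity : ∀ k a b c d → a * (k * d) - b * (k * c) ≡ k * (a * d - b * c)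
    identity = solve-∀

  negP-⊖ : ∀ X Y → negP (X ⊖ Y) ≡ Y ⊖ X
  negP-⊖ (x₁ , x₂) (y₁ , y₂) = cong₂ _,_ (identity x₁ y₁) (identity x₂ y₂)
    where
    identity : ∀ x y → - (x - y) ≡ y - x
    identity = solve-∀

  cross≡0-trans : ∀ u w {e} → cross u e ≡ 0ℤ → cross w e ≡ 0ℤ → e ≢ origin → cross u w ≡ 0ℤ
  cross≡0-trans (u₁ , u₂) (w₁ , w₂) {e₁ , e₂} u×e≡0 w×e≡0 e≢0 =
    i*j≡0∧i≢0⇒j≡0 e·e*u×w≡0 (λ e·e≡0 → ℤₚ.<-irrefl (sym e·e≡0) (dot-self>0 e≢0))
    where
    identity : ∀ u₁ u₂ w₁ w₂ e₁ e₂ →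
      (e₁ * e₁ + e₂ * e₂) * (u₁ * w₂ - u₂ * w₁) ≡
      (u₁ * e₂ - u₂ * e₁) * (e₁ * w₁ + e₂ * w₂) - (w₁ * e₂ - w₂ * e₁) * (u₁ * e₁ + u₂ * e₂)
    identity = solve-∀
    e·e*u×w≡0 : (e₁ * e₁ + e₂ * e₂) * (u₁ * w₂ - u₂ * w₁) ≡ 0ℤ
    e·e*u×w≡0 = trans (identity u₁ u₂ w₁ w₂ e₁ e₂)
      (cong₂ (λ x y → x * (e₁ * w₁ + e₂ * w₂) - y * (u₁ * e₁ + u₂ * e₂)) u×e≡0 w×e≡0)

  signed : Bool → Point → Point
  signed b v = if b then negP v else v

  signed-not-negP : ∀ b v → signed (not b) (negP v) ≡ signed b v
  signed-not-negP true v = refl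
  signed-not-negP false v = negP-involutive v

  cross-signed≡0 : ∀ b u v → cross u (signed b v) ≡ 0ℤ → cross u v ≡ 0ℤ
  cross-signed≡0 true u v u×-v≡0 = ℤₚ.neg-injective (trans (sym (cross-negPʳ u v)) u×-v≡0)
  cross-signed≡0 false u v u×v≡0 = u×v≡0

  orient : Point → Point → Point → ℤ
  orient a b c = cross (b ⊖ a) (c ⊖ a)

  orient-rotate : ∀ a b c → orient a b c ≡ orient b c a
  orient-rotate (a₁ , a₂) (b₁ , b₂) (c₁ , c₂) = identity a₁ a₂ b₁ b₂ c₁ c₂
    where
    identity : ∀ a₁ a₂ b₁ b₂ c₁ c₂ →
      (b₁ - a₁) * (c₂ - a₂) - (b₂ - a₂) * (c₁ - a₁) ≡
      (c₁ - b₁) * (a₂ - b₂) - (c₂ - b₂) * (a₁ - b₁)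
    identity = solve-∀

  orient-degenerate : ∀ a b → orient a b a ≡ 0ℤ
  orient-degenerate a b = trans (orient-rotate a b a) (cross-self (a ⊖ b))

  record SameDirection (x r : Point) : Set where
    constructor sameDirection
    field
      collinear : cross x r ≡ 0ℤ
      aligned : dot x r > 0ℤ

  sameDirection-decompose : ∀ {x r} → SameDirection x r → scale (dot r r) x ≡ scale (dot x r) r
  sameDirection-decompose {x₁ , x₂} {r₁ , r₂} (sameDirection x×r≡0 _) =
    cong₂ _,_ (drop r₂ (re x₁ x₂ r₁ r₂)) (drop (- r₁) (im x₁ x₂ r₁ r₂))
    where
    drop : ∀ {a b} d → a ≡ b + (x₁ * r₂ - x₂ * r₁) * d → a ≡ b
    drop {b = b} d eq = trans eq (trans (cong (λ c → b + c * d) x×r≡0) (ℤₚ.+-identityʳ b))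
    re : ∀ x₁ x₂ r₁ r₂ →
      (r₁ * r₁ + r₂ * r₂) * x₁ ≡ (x₁ * r₁ + x₂ * r₂) * r₁ + (x₁ * r₂ - x₂ * r₁) * r₂
    re = solve-∀
    im : ∀ x₁ x₂ r₁ r₂ →
      (r₁ * r₁ + r₂ * r₂) * x₂ ≡ (x₁ * r₁ + x₂ * r₂) * r₂ + (x₁ * r₂ - x₂ * r₁) * (- r₁)
    im = solve-∀

  sameDirection-negP : ∀ {x r} → SameDirection x r → SameDirection (negP x) (negP r)
  sameDirection-negP {x} {r} (sameDirection x×r≡0 x·r>0) =
    sameDirection (trans (cross-negP x r) x×r≡0) (subst (_> 0ℤ) (sym (dot-negP x r)) x·r>0)

  cross-sameDirectionˡ-≤0 : ∀ {x r Y} → SameDirection x r → cross r Y ≤ 0ℤ → cross x Y ≤ 0ℤ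
  cross-sameDirectionˡ-≤0 {x} {r} {Y} x∥r@(sameDirection _ x·r>0) =
    c*i≡d*j∧j≤0⇒i≤0 (dot-self>0 (dot>0⇒≢originʳ {x} x·r>0)) x·r>0 (begin
      dot r r * cross x Y           ≡⟨ sym (cross-scaleˡ (dot r r) x Y) ⟩
      cross (scale (dot r r) x) Y   ≡⟨ cong (λ v → cross v Y) (sameDirection-decompose x∥r) ⟩
      cross (scale (dot x r) r) Y   ≡⟨ cross-scaleˡ (dot x r) r Y ⟩
      dot x r * cross r Y           ∎)

  cross-sameDirectionʳ-≤0 : ∀ {x r Y} → SameDirection x r → cross Y r ≤ 0ℤ → cross Y x ≤ 0ℤ
  cross-sameDirectionʳ-≤0 {x} {r} {Y} x∥r@(sameDirection _ x·r>0) =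
    c*i≡d*j∧j≤0⇒i≤0 (dot-self>0 (dot>0⇒≢originʳ {x} x·r>0)) x·r>0 (begin
      dot r r * cross Y x           ≡⟨ sym (cross-scaleʳ (dot r r) Y x) ⟩
      cross Y (scale (dot r r) x)   ≡⟨ cong (cross Y) (sameDirection-decompose x∥r) ⟩
      cross Y (scale (dot x r) r)   ≡⟨ cross-scaleʳ (dot x r) Y r ⟩
      dot x r * cross Y r           ∎)

  H : Point → Set
  H (re , im) = im > 0ℤ ⊎ (im ≡ 0ℤ × re > 0ℤ)

  -- Defs' inH v is definitionally does (H? v).
  H? : ∀ v → Dec (H v)
  H? (re , im) = (0ℤ <? im) ⊎-dec ((im ≟ 0ℤ) ×-dec (0ℤ <? re))

  inH-reflects : ∀ v → Reflects (H v) (inH v)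
  inH-reflects v = proof (H? v)

  inH≡true⇒H : ∀ {v} → inH v ≡ true → H v
  inH≡true⇒H {v} eq = invert (subst (Reflects (H v)) eq (inH-reflects v))

  inH≡false⇒¬H : ∀ {v} → inH v ≡ false → ¬ H v
  inH≡false⇒¬H {v} eq = invert (subst (Reflects (H v)) eq (inH-reflects v))

  H⇒inH≡true : ∀ {v} → H v → inH v ≡ true
  H⇒inH≡true {v} = dec-true (H? v)

  H⇒im≥0 : ∀ {re im} → H (re , im) → im ≥ 0ℤ
  H⇒im≥0 (inj₁ im>0) = ℤₚ.<⇒≤ im>0
  H⇒im≥0 (inj₂ (refl , _)) = ℤₚ.≤-refl

  ¬H⇒im≤0 : ∀ {re im} → ¬ H (re , im) → im ≤ 0ℤ
  ¬H⇒im≤0 ¬H = ℤₚ.≮⇒≥ (¬H ∘ inj₁)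

  H⇒≢origin : ∀ {v} → H v → v ≢ origin
  H⇒≢origin (inj₁ im>0) refl = ℤₚ.<-irrefl refl im>0
  H⇒≢origin (inj₂ (_ , re>0)) refl = ℤₚ.<-irrefl refl re>0

  H-negP-exclusive : ∀ {v} → H v → ¬ H (negP v)
  H-negP-exclusive (inj₁ im>0) (inj₁ -im>0) = ℤₚ.<-asym (ℤₚ.neg-mono-< im>0) -im>0
  H-negP-exclusive (inj₁ im>0) (inj₂ (-im≡0 , _)) = ℤₚ.<-irrefl (sym (ℤₚ.neg-injective -im≡0)) im>0
  H-negP-exclusive (inj₂ (refl , _)) (inj₁ -im>0) = ℤₚ.<-irrefl refl -im>0
  H-negP-exclusive (inj₂ (_ , re>0)) (inj₂ (_ , -re>0)) = ℤₚ.<-asym (ℤₚ.neg-mono-< re>0) -re>0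

  H-negP-total : ∀ {v} → v ≢ origin → H v ⊎ H (negP v)
  H-negP-total {re , im} v≢0 with ℤₚ.<-cmp im 0ℤ | ℤₚ.<-cmp re 0ℤ
  ... | tri< im<0 _ _ | _ = inj₂ (inj₁ (ℤₚ.neg-mono-< im<0))
  ... | tri> _ _ im>0 | _ = inj₁ (inj₁ im>0)
  ... | tri≈ _ refl _ | tri< re<0 _ _ = inj₂ (inj₂ (refl , ℤₚ.neg-mono-< re<0))
  ... | tri≈ _ refl _ | tri> _ _ re>0 = inj₁ (inj₂ (refl , re>0))
  ... | tri≈ _ refl _ | tri≈ _ refl _ = ⊥-elim (v≢0 refl)

  inH-negP : ∀ {v} → v ≢ origin → inH (negP v) ≡ not (inH v)
  inH-negP {v} v≢0 = does-⇔ (mk⇔ (λ H-v Hv → H-negP-exclusive Hv H-v) from) (H? (negP v)) (¬? (H? v))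
    where
    from : ¬ H v → H (negP v)
    from ¬Hv with H-negP-total v≢0
    ... | inj₁ Hv = ⊥-elim (¬Hv Hv)
    ... | inj₂ H-v = H-v

  H-scale : ∀ {k v} → k > 0ℤ → H v → H (scale k v)
  H-scale k>0 (inj₁ im>0) = inj₁ (i>0∧j>0⇒i*j>0 k>0 im>0)
  H-scale {k} {re , _} k>0 (inj₂ (refl , re>0)) = inj₂ (ℤₚ.*-zeroʳ k , i>0∧j>0⇒i*j>0 k>0 re>0)

  H-unscale : ∀ {k v} → k ≥ 0ℤ → H (scale k v) → H v
  H-unscale {k} {re , im} k≥0 Hkv with ℤₚ.<-cmp k 0ℤ
  ... | tri< k<0 _ _ = ⊥-elim (ℤₚ.<⇒≱ k<0 k≥0)
  ... | tri≈ _ refl _ = ⊥-elim (H⇒≢origin Hkv refl)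
  ... | tri> _ _ k>0 with Hkv
  ...   | inj₁ kim>0 = inj₁ (i*j>0∧i>0⇒j>0 kim>0 k>0)
  ...   | inj₂ (kim≡0 , kre>0) =
    inj₂ (i*j≡0∧i≢0⇒j≡0 kim≡0 (ℤₚ.<⇒≢ k>0 ∘ sym) , i*j>0∧i>0⇒j>0 kre>0 k>0)

  inH-scale : ∀ {k v} → k > 0ℤ → inH (scale k v) ≡ inH v
  inH-scale {k} {v} k>0 = does-⇔ (mk⇔ (H-unscale (ℤₚ.<⇒≤ k>0)) (H-scale k>0)) (H? (scale k v)) (H? v)

  -- H (scale k g) determines the sign of k.
  inH-scale-sign : ∀ {k g u} → k ≢ 0ℤ → H (scale k g) → u ≢ origin →
                   inH (scale k u) ≡ not (inH g xor inH u)
  inH-scale-sign {k} {g} {u} k≢0 Hkg u≢0 with ℤₚ.<-cmp k 0ℤ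
  ... | tri≈ _ k≡0 _ = ⊥-elim (k≢0 k≡0)
  ... | tri> _ _ k>0 = begin
    inH (scale k u)             ≡⟨ inH-scale k>0 ⟩
    inH u                       ≡⟨ sym (not-involutive (inH u)) ⟩
    not (true xor inH u)        ≡⟨ cong (λ b → not (b xor inH u)) (sym (H⇒inH≡true Hg)) ⟩
    not (inH g xor inH u)       ∎
    where
    Hg : H g
    Hg = H-unscale (ℤₚ.<⇒≤ k>0) Hkg
  ... | tri< k<0 _ _ = begin
    inH (scale k u)             ≡⟨ cong inH (scale-as-negP u) ⟩
    inH (negP (scale (- k) u))  ≡⟨ inH-negP (λ -ku≡0 → u≢0 (scale-cancel u -k≢0 -ku≡0)) ⟩
    not (inH (scale (- k) u))   ≡⟨ cong not (inH-scale -k>0) ⟩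
    not (false xor inH u)       ≡⟨ cong (λ b → not (b xor inH u)) (sym (dec-false (H? g) ¬Hg)) ⟩
    not (inH g xor inH u)       ∎
    where
    -k>0 : - k > 0ℤ
    -k>0 = ℤₚ.neg-mono-< k<0
    -k≢0 : - k ≢ 0ℤ
    -k≢0 = ℤₚ.<⇒≢ -k>0 ∘ sym
    scale-as-negP : ∀ v → scale k v ≡ negP (scale (- k) v)
    scale-as-negP v = trans (cong (λ j → scale j v) (sym (ℤₚ.neg-involutive k))) (scale-neg (- k) v)
    ¬Hg : ¬ H g
    ¬Hg Hg = H-negP-exclusive (H-scale -k>0 Hg) (subst H (scale-as-negP g) Hkg)

  H-⊕ : ∀ {u v} → H u → H v → H (u ⊕ v)
  H-⊕ (inj₁ b>0) (inj₁ d>0) = inj₁ (ℤₚ.+-mono-< b>0 d>0)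
  H-⊕ {_ , b} (inj₁ b>0) (inj₂ (refl , _)) = inj₁ (subst (_> 0ℤ) (sym (ℤₚ.+-identityʳ b)) b>0)
  H-⊕ {_ , _} {_ , d} (inj₂ (refl , _)) (inj₁ d>0) = inj₁ (subst (_> 0ℤ) (sym (ℤₚ.+-identityˡ d)) d>0)
  H-⊕ (inj₂ (refl , a>0)) (inj₂ (refl , c>0)) = inj₂ (refl , ℤₚ.+-mono-< a>0 c>0)

  H-combination : ∀ {j k u v} → j > 0ℤ → k ≥ 0ℤ → H u → H v → H (scale j u ⊕ scale k v)
  H-combination {j} {k} {u} {v} j>0 k≥0 Hu Hv with ℤₚ.<-cmp k 0ℤ
  ... | tri< k<0 _ _ = ⊥-elim (ℤₚ.<⇒≱ k<0 k≥0)
  ... | tri≈ _ refl _ = subst H (sym (⊕-identityʳ (scale j u))) (H-scale j>0 Hu)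
  ... | tri> _ _ k>0 = H-⊕ (H-scale j>0 Hu) (H-scale k>0 Hv)

  -- As complex numbers cw P Q = P · conj Q, whose argument is the clockwise angle from P to Q.
  cw : Point → Point → Point
  cw P Q = (dot P Q , cross Q P)

  -- Whether the clockwise angle from L to X lies in [0, π).
  side : Point → Point → Bool
  side L X = inH (cw L X)

  rotμ≡cw : ∀ {P Q} → cross P Q ≤ 0ℤ → rotμ P Q ≡ cw P Q
  rotμ≡cw {P} {Q} P×Q≤0 = cong (dot P Q ,_) (trans (+∣i∣≡-i P×Q≤0) (sym (cross-antisym P Q)))

  cw-norm : ∀ L X → dot (cw L X) (cw L X) ≡ dot L L * dot X X
  cw-norm (l₁ , l₂) (x₁ , x₂) = identity l₁ l₂ x₁ x₂
    where
    identity : ∀ l₁ l₂ x₁ x₂ →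
      (l₁ * x₁ + l₂ * x₂) * (l₁ * x₁ + l₂ * x₂) + (x₁ * l₂ - x₂ * l₁) * (x₁ * l₂ - x₂ * l₁) ≡
      (l₁ * l₁ + l₂ * l₂) * (x₁ * x₁ + x₂ * x₂)
    identity = solve-∀

  cw-≢origin : ∀ {L X} → L ≢ origin → X ≢ origin → cw L X ≢ origin
  cw-≢origin {L} {X} L≢0 X≢0 cw≡0 =
    ℤₚ.<-irrefl (trans (sym (cong (λ w → dot w w) cw≡0)) (cw-norm L X))
                (i>0∧j>0⇒i*j>0 (dot-self>0 L≢0) (dot-self>0 X≢0))

  mulG-cw : ∀ L P Q → mulG (cw L P) (cw P Q) ≡ scale (dot P P) (cw L Q)
  mulG-cw (l₁ , l₂) (p₁ , p₂) (q₁ , q₂) = cong₂ _,_ (re l₁ l₂ p₁ p₂ q₁ q₂) (im l₁ l₂ p₁ p₂ q₁ q₂)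
    where
    re : ∀ l₁ l₂ p₁ p₂ q₁ q₂ →
      (l₁ * p₁ + l₂ * p₂) * (p₁ * q₁ + p₂ * q₂) - (p₁ * l₂ - p₂ * l₁) * (q₁ * p₂ - q₂ * p₁) ≡
      (p₁ * p₁ + p₂ * p₂) * (l₁ * q₁ + l₂ * q₂)
    re = solve-∀
    im : ∀ l₁ l₂ p₁ p₂ q₁ q₂ →
      (l₁ * p₁ + l₂ * p₂) * (q₁ * p₂ - q₂ * p₁) + (p₁ * l₂ - p₂ * l₁) * (p₁ * q₁ + p₂ * q₂) ≡
      (p₁ * p₁ + p₂ * p₂) * (q₁ * l₂ - q₂ * l₁)
    im = solve-∀

  scale-mulG : ∀ k w r → scale k (mulG w r) ≡ mulG (scale k w) r
  scale-mulG k (w₁ , w₂) (r₁ , r₂) = cong₂ _,_ (re k w₁ w₂ r₁ r₂) (im k w₁ w₂ r₁ r₂)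
    where
    re : ∀ k w₁ w₂ r₁ r₂ → k * (w₁ * r₁ - w₂ * r₂) ≡ (k * w₁) * r₁ - (k * w₂) * r₂
    re = solve-∀
    im : ∀ k w₁ w₂ r₁ r₂ → k * (w₁ * r₂ + w₂ * r₁) ≡ (k * w₁) * r₂ + (k * w₂) * r₁
    im = solve-∀

  cw-scaleˡ : ∀ k L X → cw (scale k L) X ≡ scale k (cw L X)
  cw-scaleˡ k (l₁ , l₂) (x₁ , x₂) = cong₂ _,_ (re k l₁ l₂ x₁ x₂) (im k l₁ l₂ x₁ x₂)
    where
    re : ∀ k l₁ l₂ x₁ x₂ → (k * l₁) * x₁ + (k * l₂) * x₂ ≡ k * (l₁ * x₁ + l₂ * x₂)
    re = solve-∀
    im : ∀ k l₁ l₂ x₁ x₂ → x₁ * (k * l₂) - x₂ * (k * l₁) ≡ k * (x₁ * l₂ - x₂ * l₁)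
    im = solve-∀

  cw-scaleʳ : ∀ k L X → cw L (scale k X) ≡ scale k (cw L X)
  cw-scaleʳ k (l₁ , l₂) (x₁ , x₂) = cong₂ _,_ (re k l₁ l₂ x₁ x₂) (im k l₁ l₂ x₁ x₂)
    where
    re : ∀ k l₁ l₂ x₁ x₂ → l₁ * (k * x₁) + l₂ * (k * x₂) ≡ k * (l₁ * x₁ + l₂ * x₂)
    re = solve-∀
    im : ∀ k l₁ l₂ x₁ x₂ → (k * x₁) * l₂ - (k * x₂) * l₁ ≡ k * (x₁ * l₂ - x₂ * l₁)
    im = solve-∀

  cw-negP : ∀ L X → cw L (negP X) ≡ negP (cw L X)
  cw-negP (l₁ , l₂) (x₁ , x₂) = cong₂ _,_ (re l₁ l₂ x₁ x₂) (im l₁ l₂ x₁ x₂)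
    where
    re : ∀ l₁ l₂ x₁ x₂ → l₁ * (- x₁) + l₂ * (- x₂) ≡ - (l₁ * x₁ + l₂ * x₂)
    re = solve-∀
    im : ∀ l₁ l₂ x₁ x₂ → (- x₁) * l₂ - (- x₂) * l₁ ≡ - (x₁ * l₂ - x₂ * l₁)
    im = solve-∀

  -- Cramer's rule, cross Z X · Y = cross Y X · Z + cross Z Y · X, pushed through cw L.
  cw-cramer : ∀ L X Y Z → scale (cross Z X) (cw L Y) ≡ scale (cross Y X) (cw L Z) ⊕ scale (cross Z Y) (cw L X)
  cw-cramer (l₁ , l₂) (x₁ , x₂) (y₁ , y₂) (z₁ , z₂) =
    cong₂ _,_ (re l₁ l₂ x₁ x₂ y₁ y₂ z₁ z₂) (im l₁ l₂ x₁ x₂ y₁ y₂ z₁ z₂)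
    where
    re : ∀ l₁ l₂ x₁ x₂ y₁ y₂ z₁ z₂ →
      (z₁ * x₂ - z₂ * x₁) * (l₁ * y₁ + l₂ * y₂) ≡
      (y₁ * x₂ - y₂ * x₁) * (l₁ * z₁ + l₂ * z₂) + (z₁ * y₂ - z₂ * y₁) * (l₁ * x₁ + l₂ * x₂)
    re = solve-∀
    im : ∀ l₁ l₂ x₁ x₂ y₁ y₂ z₁ z₂ →
      (z₁ * x₂ - z₂ * x₁) * (y₁ * l₂ - y₂ * l₁) ≡
      (y₁ * x₂ - y₂ * x₁) * (z₁ * l₂ - z₂ * l₁) + (z₁ * y₂ - z₂ * y₁) * (x₁ * l₂ - x₂ * l₁)
    im = solve-∀

  side-negP : ∀ {L X} → L ≢ origin → X ≢ origin → side L (negP X) ≡ not (side L X)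
  side-negP {L} {X} L≢0 X≢0 = trans (cong inH (cw-negP L X)) (inH-negP (cw-≢origin L≢0 X≢0))

  side-sameDirectionʳ : ∀ {L x r} → SameDirection x r → side L x ≡ side L r
  side-sameDirectionʳ {L} {x} {r} x∥r@(sameDirection _ x·r>0) = begin
    inH (cw L x)                   ≡⟨ sym (inH-scale (dot-self>0 (dot>0⇒≢originʳ {x} x·r>0))) ⟩
    inH (scale (dot r r) (cw L x)) ≡⟨ cong inH (sym (cw-scaleʳ (dot r r) L x)) ⟩
    inH (cw L (scale (dot r r) x)) ≡⟨ cong (inH ∘ cw L) (sameDirection-decompose x∥r) ⟩
    inH (cw L (scale (dot x r) r)) ≡⟨ cong inH (cw-scaleʳ (dot x r) L r) ⟩
    inH (scale (dot x r) (cw L r)) ≡⟨ inH-scale x·r>0 ⟩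
    inH (cw L r)                   ∎

  side-sameDirectionˡ : ∀ {L R X} → SameDirection L R → side L X ≡ side R X
  side-sameDirectionˡ {L} {R} {X} L∥R@(sameDirection _ L·R>0) = begin
    inH (cw L X)                   ≡⟨ sym (inH-scale (dot-self>0 (dot>0⇒≢originʳ {L} L·R>0))) ⟩
    inH (scale (dot R R) (cw L X)) ≡⟨ cong inH (sym (cw-scaleˡ (dot R R) L X)) ⟩
    inH (cw (scale (dot R R) L) X) ≡⟨ cong (λ v → inH (cw v X)) (sameDirection-decompose L∥R) ⟩
    inH (cw (scale (dot L R) R) X) ≡⟨ cong inH (cw-scaleˡ (dot L R) R X) ⟩
    inH (scale (dot L R) (cw R X)) ≡⟨ inH-scale L·R>0 ⟩
    inH (cw R X)                   ∎

  -- By cw-cramer, cw L Y is a nonnegative combination of cw L X and cw L Z.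
  H-between : ∀ {L X Y Z} → cross X Y < 0ℤ → cross Y Z ≤ 0ℤ → cross X Z ≤ 0ℤ →
              H (cw L X) → H (cw L Z) → H (cw L Y)
  H-between {L} {X} {Y} {Z} X↻Y Y↻Z X↻Z HX HZ =
    H-unscale Z×X≥0 (subst H (sym (cw-cramer L X Y Z)) (H-combination Y×X>0 Z×Y≥0 HZ HX))
    where
    Y×X>0 : cross Y X > 0ℤ
    Y×X>0 = subst (_> 0ℤ) (sym (cross-antisym X Y)) (ℤₚ.neg-mono-< X↻Y)
    Z×Y≥0 : cross Z Y ≥ 0ℤ
    Z×Y≥0 = subst (_≥ 0ℤ) (sym (cross-antisym Y Z)) (ℤₚ.neg-mono-≤ Y↻Z)
    Z×X≥0 : cross Z X ≥ 0ℤ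
    Z×X≥0 = subst (_≥ 0ℤ) (sym (cross-antisym X Z)) (ℤₚ.neg-mono-≤ X↻Z)

  side-between : ∀ {L X Y Z} → L ≢ origin → X ≢ origin → Y ≢ origin → Z ≢ origin →
    cross X Y < 0ℤ → cross Y Z ≤ 0ℤ → cross X Z ≤ 0ℤ → side L X ≡ side L Z → side L Y ≡ side L X
  side-between {L} {X} {Y} {Z} L≢0 X≢0 Y≢0 Z≢0 X↻Y Y↻Z X↻Z sX≡sZ with side L X in sX
  ... | true =
    H⇒inH≡true (H-between {L} X↻Y Y↻Z X↻Z (inH≡true⇒H {cw L X} sX) (inH≡true⇒H {cw L Z} (sym sX≡sZ)))
  ... | false = not-injective (trans (sym (side-negP L≢0 Y≢0)) (H⇒inH≡true (H-between {L}
      (subst (_< 0ℤ) (sym (cross-negP X Y)) X↻Y)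
      (subst (_≤ 0ℤ) (sym (cross-negP Y Z)) Y↻Z)
      (subst (_≤ 0ℤ) (sym (cross-negP X Z)) X↻Z)
      (inH≡true⇒H {cw L (negP X)} (trans (side-negP L≢0 X≢0) (cong not sX)))
      (inH≡true⇒H {cw L (negP Z)} (trans (side-negP L≢0 Z≢0) (cong not (sym sX≡sZ)))))))

  indicator : Bool → ℕ
  indicator true = 1
  indicator false = 0

  -- The state (k , w) encodes the angle kπ + arg w; this says that angle is congruent
  -- modulo π to the clockwise angle from L to P, i.e. w is a nonzero real multiple of cw L P.
  Tracks : Point → Point → Point → Set
  Tracks L P w = H w × Σ ℤ λ a → Σ ℤ λ b → a > 0ℤ × b ≢ 0ℤ × scale a w ≡ scale b (cw L P)

  tracks-start : ∀ {L} → L ≢ origin → Tracks L L (1ℤ , 0ℤ)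
  tracks-start {L} L≢0 =
    inj₂ (refl , +<+ z<s) , dot L L , 1ℤ , dot-self>0 L≢0 , (λ ()) ,
    cong₂ _,_ (trans (ℤₚ.*-identityʳ (dot L L)) (sym (ℤₚ.*-identityˡ (dot L L))))
              (trans (ℤₚ.*-zeroʳ (dot L L)) (sym (trans (ℤₚ.*-identityˡ (cross L L)) (cross-self L))))

  normalise-tracks : ∀ {L Q w} k s → inH w ≡ not s → L ≢ origin → Q ≢ origin →
    ∀ a b → a > 0ℤ → b ≢ 0ℤ → scale a w ≡ scale b (cw L Q) →
    let r = if inH w then (k , w) else (suc k , negP w) in
    proj₁ r ≡ k ℕ.+ indicator s × Tracks L Q (proj₂ r)
  normalise-tracks k false inH≡ _ _ a b a>0 b≢0 aw≡bLQ rewrite inH≡ =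
    sym (ℕₚ.+-identityʳ k) , inH≡true⇒H inH≡ , a , b , a>0 , b≢0 , aw≡bLQ
  normalise-tracks {L} {Q} {w} k true inH≡ L≢0 Q≢0 a b a>0 b≢0 aw≡bLQ rewrite inH≡ =
    ℕₚ.+-comm 1 k , H-w , a , - b , a>0 , b≢0 ∘ ℤₚ.neg-injective ,
    trans (scale-negP a w) (trans (cong negP aw≡bLQ) (sym (scale-neg b (cw L Q))))
    where
    w≢0 : w ≢ origin
    w≢0 refl = cw-≢origin L≢0 Q≢0 (scale-cancel (cw L Q) b≢0 (trans (sym aw≡bLQ) (scale-origin a)))
    H-w : H (negP w)
    H-w with H-negP-total w≢0
    ... | inj₁ Hw = ⊥-elim (inH≡false⇒¬H inH≡ Hw)
    ... | inj₂ H-w = H-w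

  -- As cw L P · cw P Q = |P|² · cw L Q, adding the angle of cw P Q moves the tracked point from P to Q.
  addAngle-cw : ∀ {L P Q w} k → L ≢ origin → P ≢ origin → Q ≢ origin → Tracks L P w →
    let r = addAngle (k , w) (cw P Q) in
    proj₁ r ≡ k ℕ.+ indicator (side L P xor side L Q) × Tracks L Q (proj₂ r)
  addAngle-cw {L} {P} {Q} {w} k L≢0 P≢0 Q≢0 (Hw , a , b , a>0 , b≢0 , aw≡bLP) =
    normalise-tracks k (side L P xor side L Q) inH-w′ L≢0 Q≢0 a (b * dot P P) a>0 b′≢0 aw′≡b′LQ
    where
    w′ = mulG w (cw P Q)
    b′≢0 : b * dot P P ≢ 0ℤ
    b′≢0 b′≡0 = ℤₚ.<⇒≢ (dot-self>0 P≢0) (sym (i*j≡0∧i≢0⇒j≡0 b′≡0 b≢0))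
    aw′≡b′LQ : scale a w′ ≡ scale (b * dot P P) (cw L Q)
    aw′≡b′LQ = begin
      scale a (mulG w (cw P Q))           ≡⟨ scale-mulG a w (cw P Q) ⟩
      mulG (scale a w) (cw P Q)           ≡⟨ cong (λ v → mulG v (cw P Q)) aw≡bLP ⟩
      mulG (scale b (cw L P)) (cw P Q)    ≡⟨ sym (scale-mulG b (cw L P) (cw P Q)) ⟩
      scale b (mulG (cw L P) (cw P Q))    ≡⟨ cong (scale b) (mulG-cw L P Q) ⟩
      scale b (scale (dot P P) (cw L Q))  ≡⟨ scale-scale b (dot P P) (cw L Q) ⟩
      scale (b * dot P P) (cw L Q)        ∎
    H-b′LP : H (scale (b * dot P P) (cw L P))
    H-b′LP = subst H (trans (scale-scale (dot P P) b (cw L P))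
                            (cong (λ c → scale c (cw L P)) (ℤₚ.*-comm (dot P P) b)))
                     (H-scale (dot-self>0 P≢0) (subst H aw≡bLP (H-scale a>0 Hw)))
    inH-w′ : inH w′ ≡ not (side L P xor side L Q)
    inH-w′ = begin
      inH w′                              ≡⟨ sym (inH-scale a>0) ⟩
      inH (scale a w′)                    ≡⟨ cong inH aw′≡b′LQ ⟩
      inH (scale (b * dot P P) (cw L Q))  ≡⟨ inH-scale-sign b′≢0 H-b′LP (cw-≢origin L≢0 Q≢0) ⟩
      not (side L P xor side L Q)         ∎

  lastOr : {A : Set} → A → List A → A
  lastOr d [] = d
  lastOr d (x ∷ xs) = lastOr x xs

  lastOr-++ : ∀ {A : Set} (d : A) xs ys → lastOr d (xs ++ ys) ≡ lastOr (lastOr d xs) ys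
  lastOr-++ d [] ys = refl
  lastOr-++ d (x ∷ xs) ys = lastOr-++ x xs ys

  lastOr-map : ∀ {A B : Set} (f : A → B) d xs → lastOr (f d) (map f xs) ≡ f (lastOr d xs)
  lastOr-map f d [] = refl
  lastOr-map f d (x ∷ xs) = lastOr-map f x xs

  last-∷ : ∀ {A : Set} (d : A) xs → last (d ∷ xs) ≡ just (lastOr d xs)
  last-∷ d [] = refl
  last-∷ d (x ∷ xs) = last-∷ x xs

  Chain : (Point → Point → Set) → Point → List Point → Set
  Chain R P [] = ⊤
  Chain R P (Q ∷ Qs) = R P Q × Q ≢ origin × Chain R Q Qs

  Clockwise : Point → Point → Set
  Clockwise P Q = cross P Q ≤ 0ℤ

  StrictlyClockwise : Point → Point → Set
  StrictlyClockwise P Q = cross P Q < 0ℤ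

  Chain-map : ∀ {R S : Point → Point → Set} → (∀ {P Q} → R P Q → S P Q) →
              ∀ {P} Qs → Chain R P Qs → Chain S P Qs
  Chain-map R⇒S [] _ = tt
  Chain-map R⇒S (Q ∷ Qs) (PRQ , Q≢0 , chain) = R⇒S PRQ , Q≢0 , Chain-map R⇒S Qs chain

  Chain-++ : ∀ {R P} xs ys → Chain R P xs → Chain R (lastOr P xs) ys → Chain R P (xs ++ ys)
  Chain-++ [] ys _ chain = chain
  Chain-++ (x ∷ xs) ys (PRx , x≢0 , chain) chain′ = PRx , x≢0 , Chain-++ xs ys chain chain′

  Chain-lastOr≢origin : ∀ {R P} Qs → P ≢ origin → Chain R P Qs → lastOr P Qs ≢ origin
  Chain-lastOr≢origin [] P≢0 _ = P≢0
  Chain-lastOr≢origin (Q ∷ Qs) _ (_ , Q≢0 , chain) = Chain-lastOr≢origin Qs Q≢0 chain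

  sideChanges : Point → Point → List Point → ℕ
  sideChanges L P [] = 0
  sideChanges L P (Q ∷ Qs) = indicator (side L P xor side L Q) ℕ.+ sideChanges L Q Qs

  sideChanges-++ : ∀ L P xs ys → sideChanges L P (xs ++ ys) ≡ sideChanges L P xs ℕ.+ sideChanges L (lastOr P xs) ys
  sideChanges-++ L P [] ys = refl
  sideChanges-++ L P (x ∷ xs) ys =
    trans (cong (indicator (side L P xor side L x) ℕ.+_) (sideChanges-++ L x xs ys))
          (sym (ℕₚ.+-assoc (indicator (side L P xor side L x)) _ _))

  angleSumFrom-clockwise : ∀ s {P Q} Qs → cross P Q ≤ 0ℤ →
    angleSumFrom s (P ∷ Q ∷ Qs) ≡ angleSumFrom (addAngle s (cw P Q)) (Q ∷ Qs)
  angleSumFrom-clockwise s {P} {Q} Qs P↻Q =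
    cong (λ r → angleSumFrom (addAngle s r) (Q ∷ Qs)) (rotμ≡cw {P} {Q} P↻Q)

  angleSumFrom-cw : ∀ {L} P Qs k w → L ≢ origin → P ≢ origin → Tracks L P w → Chain Clockwise P Qs →
    let r = angleSumFrom (k , w) (P ∷ Qs) in
    proj₁ r ≡ k ℕ.+ sideChanges L P Qs × Tracks L (lastOr P Qs) (proj₂ r)
  angleSumFrom-cw P [] k w _ _ tracks _ = sym (ℕₚ.+-identityʳ k) , tracks
  angleSumFrom-cw {L} P (Q ∷ Qs) k w L≢0 P≢0 tracks (P↻Q , Q≢0 , chain) =
    subst (λ r → proj₁ r ≡ k ℕ.+ sideChanges L P (Q ∷ Qs) × Tracks L (lastOr Q Qs) (proj₂ r))
          (sym (angleSumFrom-clockwise (k , w) Qs P↻Q))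
          (trans (proj₁ rest) (trans (cong (ℕ._+ sideChanges L Q Qs) (proj₁ step)) (ℕₚ.+-assoc k _ _)) ,
           proj₂ rest)
    where
    step = addAngle-cw k L≢0 P≢0 Q≢0 tracks
    rest = angleSumFrom-cw Q Qs _ _ L≢0 Q≢0 (proj₂ step) chain

  tracks-real : ∀ {L P w} → Tracks L P w → cross P L ≡ 0ℤ → proj₂ w ≡ 0ℤ × proj₁ w > 0ℤ
  tracks-real {L} {P} {re , im} (Hw , a , b , a>0 , _ , aw≡bLP) P×L≡0 = im≡0 , re>0 Hw
    where
    im≡0 : im ≡ 0ℤ
    im≡0 = i*j≡0∧i≢0⇒j≡0 (trans (cong proj₂ aw≡bLP) (trans (cong (b *_) P×L≡0) (ℤₚ.*-zeroʳ b)))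
                         (ℤₚ.<⇒≢ a>0 ∘ sym)
    re>0 : H (re , im) → re > 0ℤ
    re>0 (inj₁ im>0) = ⊥-elim (ℤₚ.<-irrefl (sym im≡0) im>0)
    re>0 (inj₂ (_ , re>0)) = re>0

  windingNumber-closedChain : ∀ {L} Qs k → L ≢ origin → Chain Clockwise L Qs →
    sideChanges L L Qs ≡ k → cross (lastOr L Qs) L ≡ 0ℤ → WindingNumberIsHalf (L ∷ Qs) k
  windingNumber-closedChain {L} Qs k L≢0 chain changes closed =
    trans (proj₁ total) changes , tracks-real {L} {lastOr L Qs} (proj₂ total) closed
    where
    total = angleSumFrom-cw L Qs 0 (1ℤ , 0ℤ) L≢0 L≢0 (tracks-start L≢0) chain

  Joined : Point → Point → Point → Set
  Joined L P Q = cross P Q ≤ 0ℤ × side L P ≡ side L Q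

  ChainSummary : Point → Point → List Point → ℕ → Point → Set
  ChainSummary L P D n Z = Chain Clockwise P D × sideChanges L P D ≡ n × lastOr P D ≡ Z

  chainSummary-cons : ∀ {L P h t D n Z} → h ≢ origin → Chain Clockwise h t → Joined L P h →
    ChainSummary L (lastOr h t) D n Z → ChainSummary L P ((h ∷ t) ++ D) (sideChanges L h t ℕ.+ n) Z
  chainSummary-cons {L} {P} {h} {t} {D} h≢0 chain (P↻h , sP≡sh) (chainD , changesD , endD) =
    Chain-++ {Clockwise} {P} (h ∷ t) D (P↻h , h≢0 , chain) chainD ,
    trans (sideChanges-++ L P (h ∷ t) D)
          (cong₂ ℕ._+_ (cong (λ s → indicator s ℕ.+ sideChanges L h t)
                             (trans (cong (side L P xor_) (sym sP≡sh)) (xor-same (side L P))))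
                       changesD) ,
    trans (lastOr-++ P (h ∷ t) D) endD

  concat-chains : ∀ {k} L P (hd : Fin (suc k) → Point) (tl : Fin (suc k) → List Point) →
    (∀ i → hd i ≢ origin) → (∀ i → Chain Clockwise (hd i) (tl i)) → Joined L P (hd zero) →
    (∀ (j : Fin k) → Joined L (lastOr (hd (inject₁ j)) (tl (inject₁ j))) (hd (suc j))) →
    ChainSummary L P (concat (tabulate (λ i → hd i ∷ tl i))) (sum (λ i → sideChanges L (hd i) (tl i)))
                 (lastOr (hd (fromℕ k)) (tl (fromℕ k)))
  concat-chains {zero} L P hd tl hd≢0 chains join₀ _ =
    chainSummary-cons {L} {P} (hd≢0 zero) (chains zero) join₀ (tt , refl , refl)
  concat-chains {suc k} L P hd tl hd≢0 chains join₀ joins =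
    chainSummary-cons {L} {P} (hd≢0 zero) (chains zero) join₀
      (concat-chains L (lastOr (hd zero) (tl zero)) (hd ∘ suc) (tl ∘ suc) (hd≢0 ∘ suc) (chains ∘ suc)
                     (joins zero) (joins ∘ suc))

  indicator-xor-trans : ∀ x y z → (x ≡ z → y ≡ x) →
    indicator (x xor y) ℕ.+ indicator (y xor z) ≡ indicator (x xor z)
  indicator-xor-trans true true z _ = refl
  indicator-xor-trans false false z _ = refl
  indicator-xor-trans true false true y≡x with () ← y≡x refl
  indicator-xor-trans true false false _ = refl
  indicator-xor-trans false true true _ = refl
  indicator-xor-trans false true false y≡x with () ← y≡x refl

  sideChanges-halfTurn : ∀ {L} X Xs → L ≢ origin → X ≢ origin → Chain StrictlyClockwise X Xs →
    All (λ Y → cross Y (lastOr X Xs) ≤ 0ℤ) (X ∷ Xs) →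
    sideChanges L X Xs ≡ indicator (side L X xor side L (lastOr X Xs))
  sideChanges-halfTurn {L} X [] _ _ _ _ = sym (cong indicator (xor-same (side L X)))
  sideChanges-halfTurn {L} X (Y ∷ Ys) L≢0 X≢0 (X↻Y , Y≢0 , chain) (X↻Z ∷ Y↻Z ∷ Ys↻Z) =
    trans (cong (indicator (side L X xor side L Y) ℕ.+_)
                (sideChanges-halfTurn Y Ys L≢0 Y≢0 chain (Y↻Z ∷ Ys↻Z)))
          (indicator-xor-trans (side L X) (side L Y) (side L Z)
            (side-between L≢0 X≢0 Y≢0 (Chain-lastOr≢origin Ys Y≢0 chain) X↻Y Y↻Z X↻Z))
    where
    Z = lastOr Y Ys

  -- A sail of the angle from direction p to direction q, translated so that its vertex is the origin.
  record SailShape (x : Point) (xs : List Point) (p q : Point) : Set where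
    field
      turns : Chain StrictlyClockwise x xs
      lastClockwise : All (λ Y → cross Y (lastOr x xs) ≤ 0ℤ) (x ∷ xs)
      startsAlong : SameDirection x p
      endsAlong : SameDirection (lastOr x xs) q

  sideChanges-sail : ∀ {L x xs p q} → L ≢ origin → SailShape x xs p q →
                     sideChanges L x xs ≡ indicator (side L p xor side L q)
  sideChanges-sail {x = x} {xs} L≢0 shape =
    trans (sideChanges-halfTurn x xs L≢0 x≢0 turns lastClockwise)
          (cong₂ (λ s t → indicator (s xor t)) (side-sameDirectionʳ startsAlong) (side-sameDirectionʳ endsAlong))
    where
    open SailShape shape
    x≢0 = dot>0⇒≢originˡ {x} (SameDirection.aligned startsAlong)

  sailShape-negP : ∀ {x xs p q} → SailShape x xs p q → SailShape (negP x) (map negP xs) (negP p) (negP q)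
  sailShape-negP {x} {xs} shape = record
    { turns = Chain-negP xs turns
    ; lastClockwise =
        subst (λ ℓ → All (λ Y → cross Y ℓ ≤ 0ℤ) (map negP (x ∷ xs))) (sym (lastOr-map negP x xs))
              (Allₚ.map⁺ (All.map (λ {Y} → subst (_≤ 0ℤ) (sym (cross-negP Y (lastOr x xs)))) lastClockwise))
    ; startsAlong = sameDirection-negP startsAlong
    ; endsAlong =
        subst (λ ℓ → SameDirection ℓ (negP _)) (sym (lastOr-map negP x xs)) (sameDirection-negP endsAlong)
    }
    where
    open SailShape shape
    Chain-negP : ∀ {P} Qs → Chain StrictlyClockwise P Qs → Chain StrictlyClockwise (negP P) (map negP Qs)
    Chain-negP [] _ = tt
    Chain-negP {P} (Q ∷ Qs) (P↻Q , Q≢0 , chain) =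
      subst (_< 0ℤ) (sym (cross-negP P Q)) P↻Q , negP-≢origin Q≢0 , Chain-negP Qs chain

  sailShape-signed : ∀ b {x xs p q} → SailShape x xs p q →
    SailShape (signed b x) (map (signed b) xs) (signed b p) (signed b q)
  sailShape-signed true = sailShape-negP
  sailShape-signed false {x} {xs} {p} {q} = subst (λ ys → SailShape x ys p q) (sym (map-id xs))

  firstOnRay⇒sameDirection : ∀ {V R X} → FirstOnRay V R X → SameDirection (X ⊖ V) (R ⊖ V)
  firstOnRay⇒sameDirection (x×r≡0 , x·r>0 , _) = sameDirection x×r≡0 x·r>0

  module _ {V P Q : Point} (angle : orient V P Q < 0ℤ) where

    inAngle⇒clockwiseOfP : ∀ X → InAngle V P Q X → cross (P ⊖ V) (X ⊖ V) ≤ 0ℤ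
    inAngle⇒clockwiseOfP X (p×x*p×q≥0 , _) = i*j≥0∧j<0⇒i≤0 p×x*p×q≥0 angle

    inAngle⇒anticlockwiseOfQ : ∀ X → InAngle V P Q X → cross (X ⊖ V) (Q ⊖ V) ≤ 0ℤ
    inAngle⇒anticlockwiseOfQ X (_ , x×q*p×q≥0) = i*j≥0∧j<0⇒i≤0 x×q*p×q≥0 angle

    -- The supporting line of ab separates c from V, so abc turns anticlockwise; the supporting line
    -- of bc then separates a from V.
    sail-turn : ∀ {a b c} → orient V a b < 0ℤ → SailSet V P Q a → SailSet V P Q c →
      SupportingEdge V P Q (a , b) → SupportingEdge V P Q (b , c) → StrictTurn (a , b , c) →
      orient V b c < 0ℤ
    sail-turn {a} {b} {c} Vab<0 a∈ c∈ (_ , ab-supports) (bcV≢0 , bc-supports) abc≢0 =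
      subst (_< 0ℤ) (sym (orient-rotate V b c)) (ℤₚ.≤∧≢⇒< bcV≤0 bcV≢0)
      where
      abV<0 : orient a b V < 0ℤ
      abV<0 = subst (_< 0ℤ) (orient-rotate V a b) Vab<0
      abc>0 : orient a b c > 0ℤ
      abc>0 = ℤₚ.≤∧≢⇒< (i*j≤0∧j<0⇒i≥0 (ab-supports c c∈) abV<0) (abc≢0 ∘ sym)
      bcV≤0 : orient b c V ≤ 0ℤ
      bcV≤0 = i*j≤0∧i>0⇒j≤0 (bc-supports a a∈) (subst (_> 0ℤ) (orient-rotate a b c) abc>0)

    sail-chain : ∀ a b cs → orient V a b < 0ℤ → All (SailSet V P Q) (a ∷ b ∷ cs) →
      All (SupportingEdge V P Q) (pairs (a ∷ b ∷ cs)) → All StrictTurn (triples (a ∷ b ∷ cs)) →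
      Chain StrictlyClockwise (b ⊖ V) (map (_⊖ V) cs)
    sail-chain a b [] _ _ _ _ = tt
    sail-chain a b (c ∷ cs) Vab<0 (a∈ ∷ b∈ ∷ c∈ ∷ ∈s) (ab ∷ bc ∷ es) (abc ∷ ts) =
      Vbc<0 , ⊖-≢origin (proj₂ c∈) , sail-chain b c cs Vbc<0 (b∈ ∷ c∈ ∷ ∈s) (bc ∷ es) ts
      where
      Vbc<0 = sail-turn Vab<0 a∈ c∈ ab bc abc

    sail-start : ∀ X₀ Xs → SameDirection (X₀ ⊖ V) (P ⊖ V) → All (SailSet V P Q) (X₀ ∷ Xs) →
      All (SupportingEdge V P Q) (pairs (X₀ ∷ Xs)) → All StrictTurn (triples (X₀ ∷ Xs)) →
      Chain StrictlyClockwise (X₀ ⊖ V) (map (_⊖ V) Xs)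
    sail-start X₀ [] _ _ _ _ = tt
    sail-start X₀ (b ∷ bs) x₀∥p (X₀∈ ∷ b∈ ∷ ∈s) (X₀b ∷ es) ts =
      VX₀b<0 , ⊖-≢origin (proj₂ b∈) , sail-chain X₀ b bs VX₀b<0 (X₀∈ ∷ b∈ ∷ ∈s) (X₀b ∷ es) ts
      where
      VX₀b<0 : orient V X₀ b < 0ℤ
      VX₀b<0 = ℤₚ.≤∧≢⇒<
        (cross-sameDirectionˡ-≤0 {Y = b ⊖ V} x₀∥p (inAngle⇒clockwiseOfP b (proj₁ b∈)))
        (proj₁ X₀b ∘ trans (sym (orient-rotate V X₀ b)))

    sail-lastClockwise : ∀ {ℓ} → SameDirection ℓ (Q ⊖ V) → ∀ Xs → All (SailSet V P Q) Xs →
      All (λ Y → cross Y ℓ ≤ 0ℤ) (map (_⊖ V) Xs)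
    sail-lastClockwise ℓ∥q Xs ∈s =
      Allₚ.map⁺ (All.map (λ {X} X∈ →
        cross-sameDirectionʳ-≤0 {Y = X ⊖ V} ℓ∥q (inAngle⇒anticlockwiseOfQ X (proj₁ X∈))) ∈s)

    isSail⇒sailShape : ∀ {S} → IsSail V P Q S →
      Σ Point λ X₀ → Σ (List Point) λ Xs →
        S ≡ X₀ ∷ Xs × SailShape (X₀ ⊖ V) (map (_⊖ V) Xs) (P ⊖ V) (Q ⊖ V)
    isSail⇒sailShape {[]} sail with _ , () , _ ← IsSail.startsOnRayP sail
    isSail⇒sailShape {X₀ ∷ Xs} sail = X₀ , Xs , refl , record
      { turns = sail-start X₀ Xs x₀∥p allInSet edges vertices
      ; lastClockwise = sail-lastClockwise ℓ∥q (X₀ ∷ Xs) allInSet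
      ; startsAlong = x₀∥p
      ; endsAlong = ℓ∥q
      }
      where
      open IsSail sail
      x₀∥p : SameDirection (X₀ ⊖ V) (P ⊖ V)
      x₀∥p = firstOnRay⇒sameDirection {V} {P} {X₀} (subst (FirstOnRay V P) (sym X₀≡X) onRay)
        where
        X₀≡X = Maybeₚ.just-injective (proj₁ (proj₂ startsOnRayP))
        onRay = proj₂ (proj₂ startsOnRayP)
      ℓ∥q : SameDirection (lastOr (X₀ ⊖ V) (map (_⊖ V) Xs)) (Q ⊖ V)
      ℓ∥q = subst (λ ℓ → SameDirection ℓ (Q ⊖ V)) (sym (lastOr-map (_⊖ V) X₀ Xs))
                  (firstOnRay⇒sameDirection {V} {Q} {lastOr X₀ Xs} (subst (FirstOnRay V Q) (sym ℓ≡X) onRay))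
        where
        ℓ≡X = Maybeₚ.just-injective (trans (sym (last-∷ X₀ Xs)) (proj₁ (proj₂ endsOnRayQ)))
        onRay = proj₂ (proj₂ endsOnRayQ)

  next-inject₁ : ∀ {m} (j : Fin m) → next (inject₁ j) ≡ suc j
  next-inject₁ {m} j = Finₚ.toℕ-injective (begin
    toℕ (next (inject₁ j))         ≡⟨ Finₚ.toℕ-fromℕ< _ ⟩
    suc (toℕ (inject₁ j)) % suc m  ≡⟨ cong (λ n → suc n % suc m) (Finₚ.toℕ-inject₁ j) ⟩
    suc (toℕ j) % suc m            ≡⟨ m<n⇒m%n≡m (s≤s (Finₚ.toℕ<n j)) ⟩
    suc (toℕ j)                    ∎)

  next-fromℕ : ∀ {m} → next (fromℕ m) ≡ zero
  next-fromℕ {m} = Finₚ.toℕ-injective (begin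
    toℕ (next (fromℕ m))           ≡⟨ Finₚ.toℕ-fromℕ< _ ⟩
    suc (toℕ (fromℕ m)) % suc m    ≡⟨ cong (λ n → suc n % suc m) (Finₚ.toℕ-fromℕ m) ⟩
    suc m % suc m                  ≡⟨ n%n≡0 (suc m) ⟩
    0                              ∎)

  prev-suc : ∀ {m} (j : Fin m) → prev (suc j) ≡ inject₁ j
  prev-suc {m} j = Finₚ.toℕ-injective (begin
    toℕ (prev (suc j))             ≡⟨ Finₚ.toℕ-fromℕ< _ ⟩
    (suc (toℕ j) ℕ.+ m) % suc m    ≡⟨ cong (_% suc m) (sym (ℕₚ.+-suc (toℕ j) m)) ⟩
    (toℕ j ℕ.+ suc m) % suc m      ≡⟨ [m+n]%n≡m%n (toℕ j) (suc m) ⟩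
    toℕ j % suc m                  ≡⟨ m<n⇒m%n≡m (ℕₚ.m<n⇒m<1+n (Finₚ.toℕ<n j)) ⟩
    toℕ j                          ≡⟨ sym (Finₚ.toℕ-inject₁ j) ⟩
    toℕ (inject₁ j)                ∎)

  prev-zero : ∀ {m} → prev {m} zero ≡ fromℕ m
  prev-zero {m} = Finₚ.toℕ-injective (begin
    toℕ (prev {m} zero)            ≡⟨ Finₚ.toℕ-fromℕ< _ ⟩
    m % suc m                      ≡⟨ m<n⇒m%n≡m (ℕₚ.n<1+n m) ⟩
    m                              ≡⟨ sym (Finₚ.toℕ-fromℕ m) ⟩
    toℕ (fromℕ m)                  ∎)

  next-prev : ∀ {m} (i : Fin (suc m)) → next (prev i) ≡ i
  next-prev zero = trans (cong next prev-zero) next-fromℕ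
  next-prev (suc j) = trans (cong next (prev-suc j)) (next-inject₁ j)

  prev≢self : ∀ {m} (i : Fin (2 ℕ.+ m)) → prev i ≢ i
  prev≢self {m} zero eq with () ← trans (sym (prev-zero {suc m})) eq
  prev≢self (suc j) eq =
    ℕₚ.1+n≢n (sym (trans (sym (Finₚ.toℕ-inject₁ j)) (cong toℕ (trans (sym (prev-suc j)) eq))))

  prev≢next : ∀ {m} (i : Fin (3 ℕ.+ m)) → prev i ≢ next i
  prev≢next {m} i with view i
  ... | ‵fromℕ = λ eq → Finₚ.0≢1+n (sym (trans (sym (prev-suc (fromℕ (suc m)))) (trans eq next-fromℕ)))
  ... | ‵inject₁ zero = λ eq →
    Finₚ.0≢1+n (sym (Finₚ.suc-injective (trans (sym prev-zero) (trans eq (next-inject₁ zero)))))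
  ... | ‵inject₁ (suc k) = λ eq → ℕₚ.m≢1+n+m (toℕ k) {1} (begin
    toℕ k                          ≡⟨ sym (trans (Finₚ.toℕ-inject₁ (inject₁ k)) (Finₚ.toℕ-inject₁ k)) ⟩
    toℕ (inject₁ (inject₁ k))
      ≡⟨ cong toℕ (trans (sym (prev-suc (inject₁ k))) (trans eq (next-inject₁ (suc k)))) ⟩
    suc (suc (toℕ k))              ∎)

  isOdd : ℕ → Bool
  isOdd k = does (k % 2 ℕ.≟ 1)

  isOdd-suc : ∀ k → isOdd (suc k) ≡ not (isOdd k)
  isOdd-suc zero = refl
  isOdd-suc (suc k) = begin
    isOdd (2 ℕ.+ k)
      ≡⟨ cong (λ r → does (r ℕ.≟ 1)) (trans (cong (_% 2) (ℕₚ.+-comm 2 k)) ([m+n]%n≡m%n k 2)) ⟩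
    isOdd k                 ≡⟨ sym (not-involutive (isOdd k)) ⟩
    not (not (isOdd k))     ≡⟨ cong not (sym (isOdd-suc k)) ⟩
    not (isOdd (suc k))     ∎

  odd : ∀ {n} → Fin n → Bool
  odd i = isOdd (toℕ i)

  odd-suc : ∀ {n} (j : Fin n) → odd (suc j) ≡ not (odd (inject₁ j))
  odd-suc j = trans (isOdd-suc (toℕ j)) (cong (not ∘ isOdd) (sym (Finₚ.toℕ-inject₁ j)))

  xor-cancelˡ : ∀ b x y → (b xor x) xor (b xor y) ≡ x xor y
  xor-cancelˡ false x y = refl
  xor-cancelˡ true true y = refl
  xor-cancelˡ true false y = not-involutive y

  agree : Bool → Bool → ℕ
  agree x y = indicator (not (x xor y))

  Descending : ∀ {m} → (Fin (suc m) → Bool) → Set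
  Descending {m} t = ∀ (j : Fin m) → t (inject₁ j) ≡ false → t (suc j) ≡ false

  descending-last : ∀ {m} (t : Fin (suc m) → Bool) → Descending t → t zero ≡ false → t (fromℕ m) ≡ false
  descending-last {zero} t _ t₀≡false = t₀≡false
  descending-last {suc m} t desc t₀≡false = descending-last (t ∘ suc) (desc ∘ suc) (desc zero t₀≡false)

  agreements-path : ∀ m (t : Fin (suc m) → Bool) → Descending t →
    sum (λ (j : Fin m) → agree (t (inject₁ j)) (t (suc j))) ℕ.+ indicator (t zero xor t (fromℕ m)) ≡ m
  agreements-path zero t _ = cong indicator (xor-same (t zero))
  agreements-path (suc m) t desc =
    extend (t zero) (t (suc zero)) (t (fromℕ (suc m))) (desc zero) (descending-last (t ∘ suc) (desc ∘ suc))
           (agreements-path m (t ∘ suc) (desc ∘ suc))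
    where
    extend : ∀ {S n} a b c → (a ≡ false → b ≡ false) → (b ≡ false → c ≡ false) →
             S ℕ.+ indicator (b xor c) ≡ n → (agree a b ℕ.+ S) ℕ.+ indicator (a xor c) ≡ suc n
    extend true true c _ _ eq = cong suc eq
    extend {S} true false false _ _ eq = trans (ℕₚ.+-comm S 1) (cong suc (trans (sym (ℕₚ.+-identityʳ S)) eq))
    extend true false true _ b⇒c with () ← b⇒c refl
    extend false false false _ _ eq = cong suc eq
    extend false false true _ b⇒c with () ← b⇒c refl
    extend false true c a⇒b _ with () ← a⇒b refl

  agreements-cycle : ∀ m (t : Fin (suc m) → Bool) → Descending t → t zero ≡ true → t (fromℕ m) ≡ false →
    sum (λ i → agree (t (prev i)) (t i)) ≡ m ∸ 1
  agreements-cycle m t desc t₀≡true tₘ≡false = begin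
    sum (λ i → agree (t (prev i)) (t i))
      ≡⟨ cong₂ ℕ._+_ (cong₂ agree (trans (cong t prev-zero) tₘ≡false) t₀≡true)
                     (sum-cong-≗ (λ j → cong (λ i → agree (t i) (t (suc j))) (prev-suc j))) ⟩
    agreements
      ≡⟨ sym (ℕₚ.m+n∸n≡m agreements 1) ⟩
    agreements ℕ.+ indicator (true xor false) ∸ 1
      ≡⟨ cong (λ b → agreements ℕ.+ indicator b ∸ 1) (sym (cong₂ _xor_ t₀≡true tₘ≡false)) ⟩
    agreements ℕ.+ indicator (t zero xor t (fromℕ m)) ∸ 1
      ≡⟨ cong (_∸ 1) (agreements-path m t desc) ⟩
    m ∸ 1 ∎
    where
    agreements = sum (λ (j : Fin m) → agree (t (inject₁ j)) (t (suc j)))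

  -- For consecutive vertices a, b, c of a convex polygon and another edge l o of it, the sign of
  -- cross e (l ⊖ o) cannot go back from ≤ 0 to ≥ 0 between the edges e = b ⊖ a and e = c ⊖ b.
  turn-back-impossible : ∀ a b c o l → orient a b c > 0ℤ → orient a b o ≥ 0ℤ → orient b c o > 0ℤ →
    orient l o b > 0ℤ → cross (b ⊖ a) (l ⊖ o) ≤ 0ℤ → cross (c ⊖ b) (l ⊖ o) ≥ 0ℤ → ⊥
  turn-back-impossible a@(a₁ , a₂) b@(b₁ , b₂) c@(c₁ , c₂) o@(o₁ , o₂) l@(l₁ , l₂)
                       abc>0 abo≥0 bco>0 lob>0 ab×lo≤0 bc×lo≥0 =
    ℤₚ.<⇒≱ (ℤₚ.+-mono-<-≤ (i>0∧j>0⇒i*j>0 abc>0 lob>0) (i≥0∧j≥0⇒i*j≥0 abo≥0 bc×lo≥0))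
           (subst (_≤ 0ℤ) (sym (identity a₁ a₂ b₁ b₂ c₁ c₂ o₁ o₂ l₁ l₂))
                  (i≥0∧j≤0⇒i*j≤0 (ℤₚ.<⇒≤ bco>0) ab×lo≤0))
    where
    identity : ∀ a₁ a₂ b₁ b₂ c₁ c₂ o₁ o₂ l₁ l₂ →
      ((b₁ - a₁) * (c₂ - a₂) - (b₂ - a₂) * (c₁ - a₁)) * ((o₁ - l₁) * (b₂ - l₂) - (o₂ - l₂) * (b₁ - l₁)) +
      ((b₁ - a₁) * (o₂ - a₂) - (b₂ - a₂) * (o₁ - a₁)) * ((c₁ - b₁) * (l₂ - o₂) - (c₂ - b₂) * (l₁ - o₁)) ≡
      ((c₁ - b₁) * (o₂ - b₂) - (c₂ - b₂) * (o₁ - b₁)) * ((b₁ - a₁) * (l₂ - o₂) - (b₂ - a₂) * (l₁ - o₁))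
    identity = solve-∀

  module Polygon {m} (A : Fin (3 ℕ.+ m) → Point) (convex : ConvexCCW A) where

    edge : Fin (3 ℕ.+ m) → Point
    edge i = A (next i) ⊖ A i

    edge×back>0 : ∀ i → cross (edge i) (A (prev i) ⊖ A i) > 0ℤ
    edge×back>0 i = convex i (prev i) (prev≢self i) (prev≢next i)

    angle-clockwise : ∀ i → orient (A i) (A (prev i)) (A (next i)) < 0ℤ
    angle-clockwise i =
      subst (_< 0ℤ) (sym (cross-antisym (edge i) (A (prev i) ⊖ A i))) (ℤₚ.neg-mono-< (edge×back>0 i))

    edge-≢origin : ∀ i → edge i ≢ origin
    edge-≢origin i = cross>0⇒≢originˡ {edge i} (edge×back>0 i)

    back≡negP-edge : ∀ i → A (prev i) ⊖ A i ≡ negP (edge (prev i))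
    back≡negP-edge i = begin
      A (prev i) ⊖ A i                       ≡⟨ sym (negP-⊖ (A i) (A (prev i))) ⟩
      negP (A i ⊖ A (prev i))                ≡⟨ cong (λ j → negP (A j ⊖ A (prev i))) (sym (next-prev i)) ⟩
      negP (A (next (prev i)) ⊖ A (prev i))  ∎

    back-≢origin : ∀ i → A (prev i) ⊖ A i ≢ origin
    back-≢origin i = subst (_≢ origin) (sym (back≡negP-edge i)) (negP-≢origin (edge-≢origin (prev i)))

    last-edge : edge (fromℕ (2 ℕ.+ m)) ≡ negP (A (prev zero) ⊖ A zero)
    last-edge = trans (cong₂ (λ i j → A i ⊖ A j) next-fromℕ (sym prev-zero))
                      (sym (negP-⊖ (A (prev zero)) (A zero)))

    orient-before-zero≥0 : ∀ k → orient (A (inject₁ (inject₁ k))) (A (suc (inject₁ k))) (A zero) ≥ 0ℤ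
    orient-before-zero≥0 zero = ℤₚ.≤-reflexive (sym (orient-degenerate (A zero) (A (suc zero))))
    orient-before-zero≥0 (suc k) =
      ℤₚ.<⇒≤ (subst (λ i → orient (A a) (A i) (A zero) > 0ℤ) (next-inject₁ (inject₁ (suc k)))
                    (convex a zero (λ ()) (λ eq → Finₚ.0≢1+n (trans eq (next-inject₁ (inject₁ (suc k)))))))
      where
      a = inject₁ (inject₁ (suc k))

    module EdgeSides {L : Point} (L∥back₀ : SameDirection L (A (prev zero) ⊖ A zero)) where

      t : Fin (3 ℕ.+ m) → Bool
      t i = side L (edge i)

      private
        R = A (prev zero) ⊖ A zero

        t≡side-R : ∀ i → t i ≡ side R (edge i)
        t≡side-R i = side-sameDirectionˡ {X = edge i} L∥back₀

      t-first : t zero ≡ true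
      t-first = trans (t≡side-R zero) (H⇒inH≡true {cw R (edge zero)} (inj₁ (edge×back>0 zero)))

      t-last : t (fromℕ (2 ℕ.+ m)) ≡ false
      t-last = begin
        t (fromℕ (2 ℕ.+ m))        ≡⟨ t≡side-R (fromℕ (2 ℕ.+ m)) ⟩
        side R (edge (fromℕ _))    ≡⟨ cong (side R) last-edge ⟩
        side R (negP R)            ≡⟨ side-negP R≢0 R≢0 ⟩
        not (side R R)             ≡⟨ cong not (H⇒inH≡true {cw R R} (inj₂ (cross-self R , dot-self>0 R≢0))) ⟩
        false                      ∎
        where
        R≢0 = back-≢origin zero

      no-turn-back : ∀ k → t (inject₁ (inject₁ k)) ≡ false → t (suc (inject₁ k)) ≢ true
      no-turn-back k ta≡false tb≡true =
        turn-back-impossible (A a) (A b) (A c) (A zero) (A (prev zero)) abc>0 (orient-before-zero≥0 k) bco>0 lob>0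
                             ab×R≤0 bc×R≥0
        where
        a = inject₁ (inject₁ k)
        b = suc (inject₁ k)
        c = suc (suc k)
        next-a : next a ≡ b
        next-a = next-inject₁ (inject₁ k)
        next-b : next b ≡ c
        next-b = next-inject₁ (suc k)
        ab×R≤0 : cross (A b ⊖ A a) R ≤ 0ℤ
        ab×R≤0 = subst (λ i → cross (A i ⊖ A a) R ≤ 0ℤ) next-a
                       (¬H⇒im≤0 (inH≡false⇒¬H {cw R (edge a)} (trans (sym (t≡side-R a)) ta≡false)))
        bc×R≥0 : cross (A c ⊖ A b) R ≥ 0ℤ
        bc×R≥0 = subst (λ i → cross (A i ⊖ A b) R ≥ 0ℤ) next-b
                       (H⇒im≥0 (inH≡true⇒H {cw R (edge b)} (trans (sym (t≡side-R b)) tb≡true)))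
        c≢a : c ≢ a
        c≢a eq = ℕₚ.m≢1+n+m (toℕ k) {1}
          (sym (trans (cong toℕ eq) (trans (Finₚ.toℕ-inject₁ (inject₁ k)) (Finₚ.toℕ-inject₁ k))))
        c≢b : c ≢ b
        c≢b eq = ℕₚ.1+n≢n (trans (cong toℕ (Finₚ.suc-injective eq)) (Finₚ.toℕ-inject₁ k))
        abc>0 : orient (A a) (A b) (A c) > 0ℤ
        abc>0 = subst (λ i → orient (A a) (A i) (A c) > 0ℤ) next-a
                      (convex a c c≢a (λ eq → c≢b (trans eq next-a)))
        bco>0 : orient (A b) (A c) (A zero) > 0ℤ
        bco>0 = subst (λ i → orient (A b) (A i) (A zero) > 0ℤ) next-b
                      (convex b zero (λ ()) (λ eq → Finₚ.0≢1+n (trans eq next-b)))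
        lob>0 : orient (A (prev zero)) (A zero) (A b) > 0ℤ
        lob>0 = subst (λ i → orient (A (prev zero)) (A i) (A b) > 0ℤ) (next-prev zero)
                      (convex (prev zero) b
                        (λ eq → Finₚ.fromℕ≢inject₁ (sym (Finₚ.suc-injective (trans eq prev-zero))))
                        (λ eq → Finₚ.0≢1+n (sym (trans eq (next-prev zero)))))

      t-descending : Descending t
      t-descending j tj≡false with view j
      ... | ‵fromℕ = t-last
      ... | ‵inject₁ k = ¬-not (no-turn-back k tj≡false)

  module SailDiagram {m} (A : Fin (3 ℕ.+ m) → Point) (convex : ConvexCCW A) (S : Fin (3 ℕ.+ m) → List Point)
                     (sails : ∀ i → IsSail (A i) (A (prev i)) (A (next i)) (S i)) where

    open Polygon A convex

    -- The i-th piece of the diagram is hd i ∷ tl i (the paper's index is toℕ i + 1).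
    σ : Fin (3 ℕ.+ m) → Point → Point
    σ i = signed (odd i)

    opaque
      private
        shape : ∀ i → Σ Point λ X₀ → Σ (List Point) λ Xs → S i ≡ X₀ ∷ Xs ×
                  SailShape (X₀ ⊖ A i) (map (_⊖ A i) Xs) (A (prev i) ⊖ A i) (A (next i) ⊖ A i)
        shape i = isSail⇒sailShape (angle-clockwise i) (sails i)

      hd : Fin (3 ℕ.+ m) → Point
      hd i = σ i (proj₁ (shape i) ⊖ A i)

      tl : Fin (3 ℕ.+ m) → List Point
      tl i = map (σ i) (map (_⊖ A i) (proj₁ (proj₂ (shape i))))

      piece≡ : ∀ i → piece A S i ≡ hd i ∷ tl i
      piece≡ i = trans (cong (map (λ X → σ i (X ⊖ A i))) (proj₁ (proj₂ (proj₂ (shape i)))))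
                       (cong (hd i ∷_) (map-∘ (proj₁ (proj₂ (shape i)))))

      pieceShape : ∀ i → SailShape (hd i) (tl i) (σ i (A (prev i) ⊖ A i)) (σ i (edge i))
      pieceShape i = sailShape-signed (odd i) (proj₂ (proj₂ (proj₂ (shape i))))

    hd≢origin : ∀ i → hd i ≢ origin
    hd≢origin i = dot>0⇒≢originˡ {hd i} (SameDirection.aligned (SailShape.startsAlong (pieceShape i)))

    L : Point
    L = hd zero

    L≢origin : L ≢ origin
    L≢origin = hd≢origin zero

    L∥back₀ : SameDirection L (A (prev zero) ⊖ A zero)
    L∥back₀ = SailShape.startsAlong (pieceShape zero)

    open EdgeSides L∥back₀

    side-signed : ∀ b {v} → v ≢ origin → side L (signed b v) ≡ b xor side L v
    side-signed true v≢0 = side-negP L≢origin v≢0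
    side-signed false _ = refl

    vertex-sideChanges : ∀ i → sideChanges L (hd i) (tl i) ≡ agree (t (prev i)) (t i)
    vertex-sideChanges i = begin
      sideChanges L (hd i) (tl i)
        ≡⟨ sideChanges-sail L≢origin (pieceShape i) ⟩
      indicator (side L (σ i (A (prev i) ⊖ A i)) xor side L (σ i (edge i)))
        ≡⟨ cong₂ (λ x y → indicator (x xor y)) (side-signed (odd i) (back-≢origin i))
                                                (side-signed (odd i) (edge-≢origin i)) ⟩
      indicator ((odd i xor side L (A (prev i) ⊖ A i)) xor (odd i xor t i))
        ≡⟨ cong (λ x → indicator ((odd i xor x) xor (odd i xor t i))) side-back ⟩
      indicator ((odd i xor not (t (prev i))) xor (odd i xor t i))
        ≡⟨ cong indicator (xor-cancelˡ (odd i) (not (t (prev i))) (t i)) ⟩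
      indicator (not (t (prev i)) xor t i)
        ≡⟨ cong indicator (sym (not-distribˡ-xor (t (prev i)) (t i))) ⟩
      agree (t (prev i)) (t i) ∎
      where
      side-back : side L (A (prev i) ⊖ A i) ≡ not (t (prev i))
      side-back = trans (cong (side L) (back≡negP-edge i)) (side-negP L≢origin (edge-≢origin (prev i)))

    ends-along-edge : ∀ i → SameDirection (lastOr (hd i) (tl i)) (σ i (edge i))
    ends-along-edge i = SailShape.endsAlong (pieceShape i)

    starts-along-previous-edge : ∀ (j : Fin (2 ℕ.+ m)) →
                                 SameDirection (hd (suc j)) (σ (inject₁ j) (edge (inject₁ j)))
    starts-along-previous-edge j =
      subst (SameDirection (hd (suc j))) previous-edge (SailShape.startsAlong (pieceShape (suc j)))
      where
      previous-edge : σ (suc j) (A (prev (suc j)) ⊖ A (suc j)) ≡ σ (inject₁ j) (edge (inject₁ j))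
      previous-edge = begin
        signed (odd (suc j)) (A (prev (suc j)) ⊖ A (suc j))
          ≡⟨ cong₂ signed (odd-suc j) (trans (back≡negP-edge (suc j)) (cong (negP ∘ edge) (prev-suc j))) ⟩
        signed (not (odd (inject₁ j))) (negP (edge (inject₁ j)))
          ≡⟨ signed-not-negP (odd (inject₁ j)) (edge (inject₁ j)) ⟩
        signed (odd (inject₁ j)) (edge (inject₁ j)) ∎

    joined : ∀ (j : Fin (2 ℕ.+ m)) → Joined L (lastOr (hd (inject₁ j)) (tl (inject₁ j))) (hd (suc j))
    joined j = ℤₚ.≤-reflexive ℓ×hd≡0 , trans (side-sameDirectionʳ ends) (sym (side-sameDirectionʳ starts))
      where
      ℓ = lastOr (hd (inject₁ j)) (tl (inject₁ j))
      ends = ends-along-edge (inject₁ j)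
      starts = starts-along-previous-edge j
      ℓ×hd≡0 : cross ℓ (hd (suc j)) ≡ 0ℤ
      ℓ×hd≡0 = cross≡0-trans ℓ (hd (suc j)) (SameDirection.collinear ends) (SameDirection.collinear starts)
                             (dot>0⇒≢originʳ {ℓ} (SameDirection.aligned ends))

    rest : List Point
    rest = tl zero ++ concat (tabulate (λ i → hd (suc i) ∷ tl (suc i)))

    sailDiagram≡ : sailDiagram A S ≡ L ∷ rest
    sailDiagram≡ = cong concat (trans (map-tabulate id (piece A S)) (tabulate-cong piece≡))

    private
      summary : ChainSummary L L (L ∷ rest) (sum (λ i → sideChanges L (hd i) (tl i)))
                             (lastOr (hd (fromℕ (2 ℕ.+ m))) (tl (fromℕ (2 ℕ.+ m))))
      summary = concat-chains L L hd tl hd≢origin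
                  (λ i → Chain-map ℤₚ.<⇒≤ (tl i) (SailShape.turns (pieceShape i)))
                  (ℤₚ.≤-reflexive (cross-self L) , refl) joined

    chain : Chain Clockwise L rest
    chain = proj₂ (proj₂ (proj₁ summary))

    sideChanges≡ : sideChanges L L rest ≡ suc m
    sideChanges≡ = begin
      sideChanges L L rest
        ≡⟨ cong (λ b → indicator b ℕ.+ sideChanges L L rest) (sym (xor-same (side L L))) ⟩
      sideChanges L L (L ∷ rest)                    ≡⟨ proj₁ (proj₂ summary) ⟩
      sum (λ i → sideChanges L (hd i) (tl i))       ≡⟨ sum-cong-≗ vertex-sideChanges ⟩
      sum (λ i → agree (t (prev i)) (t i))          ≡⟨ agreements-cycle (2 ℕ.+ m) t t-descending t-first t-last ⟩
      suc m                                         ∎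

    closed : cross (lastOr L rest) L ≡ 0ℤ
    closed = subst (λ ℓ → cross ℓ L ≡ 0ℤ) (sym (proj₂ (proj₂ summary)))
      (cross≡0-trans ℓ L ℓ×R≡0 (SameDirection.collinear L∥back₀) (back-≢origin zero))
      where
      final = fromℕ (2 ℕ.+ m)
      ℓ = lastOr (hd final) (tl final)
      ℓ×R≡0 : cross ℓ (A (prev zero) ⊖ A zero) ≡ 0ℤ
      ℓ×R≡0 = cross-signed≡0 true ℓ _ (subst (λ e → cross ℓ e ≡ 0ℤ) last-edge
                (cross-signed≡0 (odd final) ℓ (edge final) (SameDirection.collinear (ends-along-edge final))))

open import Data.Nat using (ℕ; suc; _≤_; _∸_; s≤s)
open import Data.Fin using (Fin)
open import Data.List using (List)
open import Relation.Binary.PropositionalEquality using (subst; sym)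

mainTheorem4 : (m : ℕ) → 2 ≤ m → (A : Fin (suc m) → Point) → ConvexCCW A →
    (S : Fin (suc m) → List Point) →
    (∀ i → IsSail (A i) (A (prev i)) (A (next i)) (S i)) →
    WindingNumberIsHalf (sailDiagram A S) (m ∸ 1)
mainTheorem4 (suc (suc m)) (s≤s (s≤s _)) A convex S sails =
  subst (λ D → WindingNumberIsHalf D (suc m)) (sym sailDiagram≡)
        (windingNumber-closedChain rest (suc m) L≢origin chain sideChanges≡ closed)
  where
  open SailDiagram A convex S sails
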